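{- Fix $m\ge 1$ and let $\tilde F(u_1,\dots,u_m;t)=\sum_{\pi\in\Pi^{(m)}} u_1^{a_1(\pi)}\cdots u_m^{a_m(\pi)}t^{|\pi|}$. Then, writing $\tilde F(\mathbf u;t)=\tilde F(u_1,\dots,u_m;t)$, \[ \tilde F(\mathbf u;t)=u_1\cdots u_m+t\,u_1\cdots u_m\,\tilde F(\mathbf u;t)+t u_1\frac{\tilde F(\mathbf u;t)-u_1\tilde F(1,u_2,\dots,u_m;t)}{u_1-1} +t\sum_{j=2}^m u_1u_2\cdots u_j\,\frac{\tilde F(\mathbf u;t)-\tilde F(u_1,\dots,u_{j-2},u_{j-1}u_j,1,u_{j+1},\dots,u_m;t)}{u_j-1}. \]
   Context: A set partition of $[n]=\{1,\dots,n\}$ ($n\ge0$) is a collection of nonempty pairwise disjoint blocks with union $[n]$; $|\pi|=n$. Its arcs are the pairs $(i,j)$, $i<j$, of consecutive elements (in numerical order) of a same block. A $k$-nesting is a set of $k$ arcs $(i_1,j_1),\dots,(i_k,j_k)$ with $i_1<\dots<i_k<j_k<\dots<j_1$ (a single arc is a $1$-nesting); a partition is $k$-nonnesting if it has no $k$-nesting. $\Pi^{(m)}$ denotes the set of all set partitions (of all sizes $n\ge0$) containing no $(m+1)$-nesting. Blocks are ordered by decreasing maximal element. For $1\le j\le m$, $a_j(\pi)$ is $1+$(number of blocks of $\pi$) if $\pi$ is $j$-nonnesting, and otherwise $1+$ the number of blocks whose maximal element is strictly greater than the largest value, over all $j$-nestings of $\pi$, of the smallest vertex of the $j$-nesting.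 The empty partition has $a_j=1$ for all $j$. $\tilde F$ is a formal power series in $t$ with polynomial coefficients in $u_1,\dots,u_m$. -}

module Defs where

open import Data.Bool using (Bool; true; false; _∧_; _∨_; not; if_then_else_)
open import Data.Nat as ℕ using (ℕ; zero; suc; _≤ᵇ_; _<ᵇ_; _≡ᵇ_; _⊔_)
open import Data.Integer as ℤ using (ℤ)
open import Data.List using (List; []; _∷_; _++_; map; concatMap; length; foldr)
open import Data.Vec using (Vec; []; _∷_; tabulate)
open import Data.Fin using (Fin; toℕ)
open import Data.Product using (_×_; _,_; proj₁; proj₂)
open import Relation.Binary.PropositionalEquality using (_≡_)

bfilter : {A : Set} → (A → Bool) → List A → List A
bfilter p [] = []
bfilter p (x ∷ xs) = if p x then x ∷ bfilter p xs else bfilter p xs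

anyB : {A : Set} → (A → Bool) → List A → Bool
anyB p [] = false
anyB p (x ∷ xs) = p x ∨ anyB p xs

allB : {A : Set} → (A → Bool) → List A → Bool
allB p [] = true
allB p (x ∷ xs) = p x ∧ allB p xs

range0 : ℕ → List ℕ
range0 zero = []
range0 (suc k) = range0 k ++ (k ∷ [])

rangeFT : ℕ → ℕ → List ℕ
rangeFT a b = bfilter (λ x → a ≤ᵇ x) (range0 (suc b))

maxL : List ℕ → ℕ
maxL = foldr _⊔_ 0

-- Set partitions of [n], encoded by restricted growth strings.
-- A partition π of [n] = {1..n} is encoded by the list ℓ = (ℓ₁,…,ℓₙ) of
-- block labels: i and j lie in the same block iff ℓᵢ = ℓⱼ, with the
-- canonical normalisation ℓ₁ = 0 and ℓᵢ ≤ 1 + max(ℓ₁,…,ℓᵢ₋₁)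
-- (labels in order of first appearance).  This is a bijection between
-- restricted growth strings of length n and set partitions of [n].

allLists : ℕ → ℕ → List (List ℕ)
allLists zero k = [] ∷ []
allLists (suc n) k = concatMap (λ x → map (x ∷_) (allLists n k)) (range0 k)

-- restricted-growth check; b = 1 + (max of labels so far), 0 initially
rgsFrom : ℕ → List ℕ → Bool
rgsFrom b [] = true
rgsFrom b (x ∷ xs) = (x ≤ᵇ b) ∧ rgsFrom (b ⊔ suc x) xs

isRGS : List ℕ → Bool
isRGS = rgsFrom 0

Partition : Set
Partition = List ℕ

size : Partition → ℕ
size = length

partitionsOf : ℕ → List Partition
partitionsOf n = bfilter isRGS (allLists n n)

-- label of element i ∈ [n] (1-based)
labelAt : Partition → ℕ → ℕ
labelAt [] i = 0
labelAt (x ∷ xs) zero = 0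
labelAt (x ∷ xs) (suc zero) = x
labelAt (x ∷ xs) (suc (suc i)) = labelAt xs (suc i)

ground : Partition → List ℕ
ground π = rangeFT 1 (size π)

sameBlock : Partition → ℕ → ℕ → Bool
sameBlock π i j = labelAt π i ≡ᵇ labelAt π j

blocks : Partition → List ℕ
blocks π = bfilter (λ b → anyB (λ i → labelAt π i ≡ᵇ b) (ground π)) (range0 (size π))

blockElems : Partition → ℕ → List ℕ
blockElems π b = bfilter (λ i → labelAt π i ≡ᵇ b) (ground π)

blockMax : Partition → ℕ → ℕ
blockMax π b = maxL (blockElems π b)

Arc : Set
Arc = ℕ × ℕ

isArc : Partition → ℕ → ℕ → Bool
isArc π i j = (i <ᵇ j) ∧ sameBlock π i j
  ∧ allB (λ k → not ((i <ᵇ k) ∧ (k <ᵇ j) ∧ sameBlock π i k)) (ground π)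

arcs : Partition → List Arc
arcs π = concatMap (λ i → map (i ,_) (bfilter (λ j → isArc π i j) (ground π))) (ground π)

tuples : {A : Set} → ℕ → List A → List (List A)
tuples zero xs = [] ∷ []
tuples (suc k) xs = concatMap (λ x → map (x ∷_) (tuples k xs)) xs

-- (i₁,j₁),…,(i_k,j_k) with i₁<…<i_k and j_k<…<j₁ (i_k<j_k holds for arcs)
chain : List Arc → Bool
chain [] = true
chain (a ∷ []) = true
chain ((i , j) ∷ (i' , j') ∷ rest) = (i <ᵇ i') ∧ (j' <ᵇ j) ∧ chain ((i' , j') ∷ rest)

-- the k-nestings of π, each listed from the outermost arc inwards
nestings : ℕ → Partition → List (List Arc)
nestings k π = bfilter chain (tuples k (arcs π))

hasNesting : ℕ → Partition → Bool
hasNesting k π = anyB (λ _ → true) (nestings k π)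

-- smallest vertex of a nesting (listed outermost first) = i₁
smallestVertex : List Arc → ℕ
smallestVertex [] = 0
smallestVertex ((i , j) ∷ _) = i

inΠ : ℕ → Partition → Bool
inΠ m π = not (hasNesting (suc m) π)

aStat : ℕ → Partition → ℕ
aStat j π =
  if not (hasNesting j π)
  then suc (length (blocks π))
  else suc (length (bfilter (λ b → v <ᵇ blockMax π b) (blocks π)))
  where
  v : ℕ
  v = maxL (map smallestVertex (nestings j π))

-- Polynomials in u₁,…,u_m with integer coefficients, as formal sums of
-- monomials c·u^e (e ∈ ℕ^m); two polynomials are equal when all their
-- coefficients agree.

Exp : ℕ → Set
Exp m = Vec ℕ m

Poly : ℕ → Set
Poly m = List (ℤ × Exp m)

eqExp : {m : ℕ} → Exp m → Exp m → Bool
eqExp [] [] = true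
eqExp (x ∷ xs) (y ∷ ys) = (x ≡ᵇ y) ∧ eqExp xs ys

coeff : {m : ℕ} → Poly m → Exp m → ℤ
coeff p e = foldr ℤ._+_ (ℤ.+ 0) (map proj₁ (bfilter (λ t → eqExp (proj₂ t) e) p))

_≈P_ : {m : ℕ} → Poly m → Poly m → Set
p ≈P q = ∀ e → coeff p e ≡ coeff q e

zeroE : (m : ℕ) → Exp m
zeroE m = tabulate (λ _ → 0)

addE : {m : ℕ} → Exp m → Exp m → Exp m
addE [] [] = []
addE (x ∷ xs) (y ∷ ys) = (x ℕ.+ y) ∷ addE xs ys

-- 1-based access / update of exponent vectors
getE : {m : ℕ} → Exp m → ℕ → ℕ
getE [] j = 0
getE (x ∷ xs) zero = 0
getE (x ∷ xs) (suc zero) = x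
getE (x ∷ xs) (suc (suc j)) = getE xs (suc j)

setE : {m : ℕ} → Exp m → ℕ → ℕ → Exp m
setE [] j v = []
setE (x ∷ xs) zero v = x ∷ xs
setE (x ∷ xs) (suc zero) v = v ∷ xs
setE (x ∷ xs) (suc (suc j)) v = x ∷ setE xs (suc j) v

_⊕_ : {m : ℕ} → Poly m → Poly m → Poly m
p ⊕ q = p ++ q

⊖_ : {m : ℕ} → Poly m → Poly m
⊖ p = map (λ t → ℤ.- proj₁ t , proj₂ t) p

_⊗_ : {m : ℕ} → Poly m → Poly m → Poly m
p ⊗ q = concatMap (λ s → map (λ t → proj₁ s ℤ.* proj₁ t , addE (proj₂ s) (proj₂ t)) q) p

monomial : {m : ℕ} → Exp m → Poly m
monomial e = (ℤ.+ 1 , e) ∷ []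

onePoly : (m : ℕ) → Poly m
onePoly m = monomial (zeroE m)

var : (m : ℕ) → ℕ → Poly m
var m j = monomial (setE (zeroE m) j 1)

prodU : (m : ℕ) → ℕ → Poly m
prodU m k = monomial (tabulate (λ (i : Fin m) → if suc (toℕ i) ≤ᵇ k then 1 else 0))

substE : {m : ℕ} → (Exp m → Exp m) → Poly m → Poly m
substE f p = map (λ t → proj₁ t , f (proj₂ t)) p

FPS : ℕ → Set
FPS m = ℕ → Poly m

_≈F_ : {m : ℕ} → FPS m → FPS m → Set
F ≈F G = ∀ n → F n ≈P G n

_⊕F_ : {m : ℕ} → FPS m → FPS m → FPS m
(F ⊕F G) n = F n ⊕ G n

⊖F_ : {m : ℕ} → FPS m → FPS m
(⊖F F) n = ⊖ (F n)

_·F_ : {m : ℕ} → Poly m → FPS m → FPS m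
(p ·F F) n = p ⊗ F n

tF : {m : ℕ} → FPS m → FPS m
tF F zero = []
tF F (suc n) = F n

constF : {m : ℕ} → Poly m → FPS m
constF p zero = p
constF p (suc n) = []

sumF : {m : ℕ} → List (FPS m) → FPS m
sumF {m} [] n = []
sumF (F ∷ Fs) = F ⊕F sumF Fs

substF : {m : ℕ} → (Exp m → Exp m) → FPS m → FPS m
substF f F n = substE f (F n)

aVec : (m : ℕ) → Partition → Exp m
aVec m π = tabulate (λ (j : Fin m) → aStat (suc (toℕ j)) π)

Ftilde : (m : ℕ) → FPS m
Ftilde m n = map (λ π → ℤ.+ 1 , aVec m π) (bfilter (inΠ m) (partitionsOf n))

-- u₁ ↦ 1 :  F̃(1,u₂,…,u_m;t)
σ₁ : {m : ℕ} → Exp m → Exp m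
σ₁ e = setE e 1 0

-- for 2 ≤ j ≤ m : u_{j-1} ↦ u_{j-1}u_j, u_j ↦ 1, i.e. u^e ↦ u^{e'} with
-- e'_j = e_{j-1} and all other exponents unchanged:
-- F̃(u₁,…,u_{j-2},u_{j-1}u_j,1,u_{j+1},…,u_m;t)
σ : {m : ℕ} → ℕ → Exp m → Exp m
σ j e = setE e j (getE e (j ℕ.∸ 1))

numer : (m : ℕ) → ℕ → FPS m
numer m zero = λ _ → []
numer m (suc zero) = Ftilde m ⊕F (⊖F (var m 1 ·F substF σ₁ (Ftilde m)))
numer m (suc (suc j)) = Ftilde m ⊕F (⊖F substF (σ (suc (suc j))) (Ftilde m))

IsQuotient : (m : ℕ) → ℕ → FPS m → Set
IsQuotient m j Q = ((var m j ⊕ (⊖ onePoly m)) ·F Q) ≈F numer m j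

RHS : (m : ℕ) → (ℕ → FPS m) → FPS m
RHS m Q =
  constF (prodU m m)
  ⊕F (tF (prodU m m ·F Ftilde m)
  ⊕F (tF (var m 1 ·F Q 1)
  ⊕F sumF (map (λ j → tF (prodU m j ·F Q j)) (rangeFT 2 m))))

module Submission where

-- Every partition of [n+1] arises exactly once from a partition π of [n] by putting n+1 into a
-- block of π or into a new block.  The only new arc ends at n+1, so a new nesting has outer arc
-- (M, n+1), where M is the maximum of the block receiving n+1.  Writing v_k(π) for the largest
-- smallest vertex of a k-nesting (0 if there is none), a_k(π) = 1 + #{blocks with maximum > v_k(π)}.
-- A new block raises every a_k by one: the term t u₁⋯u_m F̃.  Joining the block with maximum M,
-- where v_j(π) < M ≤ v_{j-1}(π), keeps π in Π^(m) iff v_m(π) < M; it raises a_1, …, a_{j-1} by one,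
-- sets a_j to 2 + #{blocks with maximum > M} and leaves a_{j+1}, …, a_m alone.  For fixed π and j these
-- new values of a_j run through an interval of consecutive integers, so the contribution of π is a
-- geometric sum in u_j, which is the j-th divided difference of the functional equation.

open import Defs
import Data.Integer.Properties as ℤP
open import Algebra.Bundles using (AbelianGroup)
open import Algebra.Properties.CommutativeSemigroup ℤP.+-commutativeSemigroup using (interchange)
open import Algebra.Properties.Group (AbelianGroup.group ℤP.+-0-abelianGroup) using (∙-cancelʳ)
open import Data.Bool using (Bool; true; false; _∧_; _∨_; not; if_then_else_; T)
open import Data.Bool.Properties using (T-∨; ∨-zeroʳ; ∨-identityʳ)
open import Data.Empty using (⊥-elim)
open import Data.Integer as ℤ using (ℤ; +_; -[1+_])
open import Data.Integer.Tactic.RingSolver using (solve-∀)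
open import Data.List using (List; []; _∷_; _++_; map; concatMap; length; filterᵇ; initLast; _∷ʳ′_)
import Data.List.Properties as LP
open import Data.List.Properties using (filter-++; filter-all; filter-none)
open import Data.List.Membership.Propositional using (_∈_; find; lose)
open import Data.List.Membership.Propositional.Properties using (∈-++⁺ˡ; ∈-++⁺ʳ; ∈-++⁻; ∈-map⁺; ∈-map⁻; ∈-concatMap⁺; ∈-concatMap⁻; ∈-filter⁺; ∈-filter⁻)
open import Data.List.Relation.Unary.Any using (here; there)
open import Data.List.Relation.Unary.All as All using (All; []; _∷_)
open import Data.List.Relation.Binary.Permutation.Propositional as ↭ using (_↭_)
import Data.List.Relation.Binary.Permutation.Propositional.Properties as ↭P
open import Data.List.Relation.Binary.BagAndSetEquality using (∼bag⇒↭)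
open import Data.List.Membership.Propositional.Properties.WithK using (unique∧set⇒bag)
open import Data.List.Relation.Unary.Unique.Propositional using (Unique)
open import Data.List.Relation.Unary.AllPairs using ([]; _∷_)
import Data.List.Relation.Unary.Unique.Propositional.Properties as Unique
open import Data.Nat as ℕ using (ℕ; zero; suc; _≤ᵇ_; _<ᵇ_; _≡ᵇ_; _⊔_; _+_; _∸_; _≤_; _<_; z≤n; s≤s; s≤s⁻¹; _≟_)
open import Data.Nat.Properties
open import Data.Product using (_×_; _,_; proj₁; proj₂; Σ; ∃-syntax)
open import Data.Vec using ([]; _∷_; tabulate)
open import Data.Fin using (Fin; toℕ)
open import Data.Sum using (_⊎_; inj₁; inj₂)
open import Data.Unit using (tt; ⊤)
open import Level using (0ℓ)
open import Function using (_∘_; case_of_; Equivalence; mk⇔)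
open import Relation.Binary using (Setoid; tri<; tri≈; tri>)
open import Relation.Binary.PropositionalEquality
import Relation.Binary.Reasoning.Setoid as SetoidReasoning
open import Relation.Nullary using (¬_; yes; no)
open import Relation.Nullary.Decidable using (T?)

private variable
  A B C : Set

T-∧-intro : ∀ {a b} → T a → T b → T (a ∧ b)
T-∧-intro {true} {true} _ _ = tt

T-∧-fst : ∀ {a b} → T (a ∧ b) → T a
T-∧-fst {true} _ = tt

T-∧-snd : ∀ {a b} → T (a ∧ b) → T b
T-∧-snd {true} t = t

T-∨-elim : ∀ {a b} → T (a ∨ b) → T a ⊎ T b
T-∨-elim {a} = Equivalence.to (T-∨ {a})

T-∨-inl : ∀ {a b} → T a → T (a ∨ b)
T-∨-inl {a} t = Equivalence.from (T-∨ {a}) (inj₁ t)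

T-∨-inr : ∀ {a b} → T b → T (a ∨ b)
T-∨-inr {a} t = Equivalence.from (T-∨ {a}) (inj₂ t)

T-not⁻ : ∀ {a} → T (not a) → ¬ T a
T-not⁻ {false} _ ()

T-not⁺ : ∀ {a} → ¬ T a → T (not a)
T-not⁺ {true} h = h tt
T-not⁺ {false} _ = tt

T-true : ∀ {a} → T a → a ≡ true
T-true {true} _ = refl

¬T-false : ∀ {a} → ¬ T a → a ≡ false
¬T-false {true} h = ⊥-elim (h tt)
¬T-false {false} _ = refl

T-ext : ∀ {a b} → (T a → T b) → (T b → T a) → a ≡ b
T-ext {true} f _ = sym (T-true (f tt))
T-ext {false} _ g = sym (¬T-false g)

bfilter≡filterᵇ : (p : A → Bool) (xs : List A) → bfilter p xs ≡ filterᵇ p xs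
bfilter≡filterᵇ p [] = refl
bfilter≡filterᵇ p (x ∷ xs) with p x
... | true = cong (x ∷_) (bfilter≡filterᵇ p xs)
... | false = bfilter≡filterᵇ p xs

∈-bfilter⁻ : (p : A → Bool) (xs : List A) {x : A} → x ∈ bfilter p xs → x ∈ xs × T (p x)
∈-bfilter⁻ p xs h = ∈-filter⁻ (T? ∘ p) (subst (_ ∈_) (bfilter≡filterᵇ p xs) h)

∈-bfilter⁺ : (p : A → Bool) (xs : List A) {x : A} → x ∈ xs → T (p x) → x ∈ bfilter p xs
∈-bfilter⁺ p xs x∈ px = subst (_ ∈_) (sym (bfilter≡filterᵇ p xs)) (∈-filter⁺ (T? ∘ p) x∈ px)

bfilter-++ : (p : A → Bool) (xs ys : List A) → bfilter p (xs ++ ys) ≡ bfilter p xs ++ bfilter p ys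
bfilter-++ p xs ys = begin
  bfilter p (xs ++ ys)           ≡⟨ bfilter≡filterᵇ p (xs ++ ys) ⟩
  filterᵇ p (xs ++ ys)           ≡⟨ filter-++ (T? ∘ p) xs ys ⟩
  filterᵇ p xs ++ filterᵇ p ys   ≡⟨ cong₂ _++_ (bfilter≡filterᵇ p xs) (bfilter≡filterᵇ p ys) ⟨
  bfilter p xs ++ bfilter p ys   ∎
  where open ≡-Reasoning

bfilter-↭ : (p : A → Bool) {xs ys : List A} → xs ↭ ys → bfilter p xs ↭ bfilter p ys
bfilter-↭ p {xs} {ys} xs↭ys =
  subst₂ _↭_ (sym (bfilter≡filterᵇ p xs)) (sym (bfilter≡filterᵇ p ys)) (↭P.filter-↭ (T? ∘ p) xs↭ys)

bfilter-cong : (p q : A → Bool) (xs : List A) → (∀ x → x ∈ xs → p x ≡ q x) → bfilter p xs ≡ bfilter q xs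
bfilter-cong p q [] _ = refl
bfilter-cong p q (x ∷ xs) h with p x | q x | h x (here refl)
... | true | true | _ = cong (x ∷_) (bfilter-cong p q xs (λ y y∈ → h y (there y∈)))
... | false | false | _ = bfilter-cong p q xs (λ y y∈ → h y (there y∈))

bfilter-all : (p : A → Bool) (xs : List A) → (∀ x → x ∈ xs → T (p x)) → bfilter p xs ≡ xs
bfilter-all p xs h = trans (bfilter≡filterᵇ p xs) (filter-all (T? ∘ p) (All.tabulate (h _)))

bfilter-none : (p : A → Bool) (xs : List A) → (∀ x → x ∈ xs → ¬ T (p x)) → bfilter p xs ≡ []
bfilter-none p xs h = trans (bfilter≡filterᵇ p xs) (filter-none (T? ∘ p) (All.tabulate (h _)))

length-bfilter-++ : (p : A → Bool) (xs ys : List A) →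
  length (bfilter p (xs ++ ys)) ≡ length (bfilter p xs) + length (bfilter p ys)
length-bfilter-++ p xs ys rewrite bfilter-++ p xs ys = LP.length-++ (bfilter p xs)

anyB⁻ : (p : A → Bool) (xs : List A) → T (anyB p xs) → ∃[ x ] x ∈ xs × T (p x)
anyB⁻ p (x ∷ xs) h with T-∨-elim {p x} h
... | inj₁ px = x , here refl , px
... | inj₂ r = let (y , y∈ , py) = anyB⁻ p xs r in y , there y∈ , py

anyB⁺ : (p : A → Bool) (xs : List A) {x : A} → x ∈ xs → T (p x) → T (anyB p xs)
anyB⁺ p (y ∷ xs) (here refl) px = T-∨-inl {p y} px
anyB⁺ p (y ∷ xs) (there x∈) px = T-∨-inr {p y} (anyB⁺ p xs x∈ px)

allB⁻ : (p : A → Bool) (xs : List A) → T (allB p xs) → ∀ {x} → x ∈ xs → T (p x)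
allB⁻ p (y ∷ xs) h (here refl) = T-∧-fst h
allB⁻ p (y ∷ xs) h (there x∈) = allB⁻ p xs (T-∧-snd {p y} h) x∈

allB⁺ : (p : A → Bool) (xs : List A) → (∀ {x} → x ∈ xs → T (p x)) → T (allB p xs)
allB⁺ p [] _ = tt
allB⁺ p (y ∷ xs) h = T-∧-intro (h (here refl)) (allB⁺ p xs (h ∘ there))

∈-range0⁻ : ∀ {x} k → x ∈ range0 k → x < k
∈-range0⁻ (suc k) h with ∈-++⁻ (range0 k) h
... | inj₁ x∈ = m≤n⇒m≤1+n (∈-range0⁻ k x∈)
... | inj₂ (here refl) = ≤-refl

∈-range0⁺ : ∀ {x} k → x < k → x ∈ range0 k
∈-range0⁺ (suc k) x<1+k with m≤n⇒m<n∨m≡n (s≤s⁻¹ x<1+k)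
... | inj₁ x<k = ∈-++⁺ˡ (∈-range0⁺ k x<k)
... | inj₂ refl = ∈-++⁺ʳ (range0 k) (here refl)

∈-rangeFT⁻ : ∀ {x} a b → x ∈ rangeFT a b → a ≤ x × x ≤ b
∈-rangeFT⁻ a b h = let (x∈ , a≤x) = ∈-bfilter⁻ (a ≤ᵇ_) (range0 (suc b)) h in
  ≤ᵇ⇒≤ a _ a≤x , s≤s⁻¹ (∈-range0⁻ (suc b) x∈)

∈-rangeFT⁺ : ∀ {x} a b → a ≤ x → x ≤ b → x ∈ rangeFT a b
∈-rangeFT⁺ a b a≤x x≤b = ∈-bfilter⁺ (a ≤ᵇ_) (range0 (suc b)) (∈-range0⁺ (suc b) (s≤s x≤b)) (≤⇒≤ᵇ a≤x)

rangeFT-suc : ∀ a b → a ≤ suc b → rangeFT a (suc b) ≡ rangeFT a b ++ suc b ∷ []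
rangeFT-suc a b a≤ rewrite bfilter-++ (a ≤ᵇ_) (range0 (suc b)) (suc b ∷ []) | T-true (≤⇒≤ᵇ a≤) = refl

maxL-ub : ∀ {x} (xs : List ℕ) → x ∈ xs → x ≤ maxL xs
maxL-ub (y ∷ xs) (here refl) = m≤m⊔n y (maxL xs)
maxL-ub (y ∷ xs) (there x∈) = ≤-trans (maxL-ub xs x∈) (m≤n⊔m y (maxL xs))

maxL-lub : ∀ {y} (xs : List ℕ) → (∀ {x} → x ∈ xs → x ≤ y) → maxL xs ≤ y
maxL-lub [] _ = z≤n
maxL-lub (x ∷ xs) h = ⊔-lub (h (here refl)) (maxL-lub xs (h ∘ there))

maxL-∈ : (xs : List ℕ) → maxL xs ≡ 0 ⊎ maxL xs ∈ xs
maxL-∈ [] = inj₁ refl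
maxL-∈ (x ∷ xs) with ⊔-sel x (maxL xs)
... | inj₁ eq = inj₂ (here eq)
... | inj₂ eq with maxL-∈ xs
...   | inj₁ z = inj₁ (trans eq z)
...   | inj₂ x∈ = inj₂ (there (subst (_∈ xs) (sym eq) x∈))

split-implied : ∀ a b → (T b → T a) → a ≡ b ∨ (a ∧ not b)
split-implied true true _ = refl
split-implied true false _ = refl
split-implied false true h = ⊥-elim (h tt)
split-implied false false _ = refl

split-implied-disjoint : ∀ a b → ¬ (T b × T (a ∧ not b))
split-implied-disjoint true true (_ , ())
split-implied-disjoint false true (_ , ())

upFrom : ℕ → ℕ → List ℕ
upFrom lo zero = []
upFrom lo (suc k) = lo ∷ upFrom (suc lo) k

upFrom-+ : ∀ lo a b → upFrom lo (a + b) ≡ upFrom lo a ++ upFrom (lo + a) b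
upFrom-+ lo zero b = cong (λ l → upFrom l b) (sym (+-identityʳ lo))
upFrom-+ lo (suc a) b = cong (lo ∷_) (trans (upFrom-+ (suc lo) a b) (cong (λ l → upFrom (suc lo) a ++ upFrom l b) (sym (+-suc lo a))))

upFrom-suc : ∀ lo k → upFrom lo (suc k) ≡ upFrom lo k ++ (lo + k) ∷ []
upFrom-suc lo k = trans (cong (upFrom lo) (+-comm 1 k)) (upFrom-+ lo k 1)

guard : Bool → List A → List A
guard b l = if b then l else []

guard-cong : (b : Bool) {l l' : List A} → (T b → l ≡ l') → guard b l ≡ guard b l'
guard-cong true h = h tt
guard-cong false h = refl

concatMap-cong-∈ : (f g : A → List B) (xs : List A) → (∀ x → x ∈ xs → f x ≡ g x) → concatMap f xs ≡ concatMap g xs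
concatMap-cong-∈ f g [] h = refl
concatMap-cong-∈ f g (x ∷ xs) h = cong₂ _++_ (h x (here refl)) (concatMap-cong-∈ f g xs (λ y y∈ → h y (there y∈)))

concatMap-[] : (f : A → List B) (xs : List A) → (∀ x → x ∈ xs → f x ≡ []) → concatMap f xs ≡ []
concatMap-[] f [] h = refl
concatMap-[] f (x ∷ xs) h rewrite h x (here refl) = concatMap-[] f xs (λ y y∈ → h y (there y∈))

concatMap-bfilter : (p : A → Bool) (f : A → List B) (xs : List A) → (∀ x → x ∈ xs → ¬ T (p x) → f x ≡ []) →
  concatMap f (bfilter p xs) ≡ concatMap f xs
concatMap-bfilter p f [] h = refl
concatMap-bfilter p f (x ∷ xs) h with p x in eq
... | true = cong (f x ++_) (concatMap-bfilter p f xs (λ y y∈ → h y (there y∈)))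
... | false rewrite h x (here refl) (subst T eq) = concatMap-bfilter p f xs (λ y y∈ → h y (there y∈))

bfilter-concatMap : (p : B → Bool) (f : A → List B) (xs : List A) → bfilter p (concatMap f xs) ≡ concatMap (bfilter p ∘ f) xs
bfilter-concatMap p f [] = refl
bfilter-concatMap p f (x ∷ xs) = trans (bfilter-++ p (f x) _) (cong (bfilter p (f x) ++_) (bfilter-concatMap p f xs))

map-as-concatMap : (f : A → B) (xs : List A) → map f xs ≡ concatMap (λ x → f x ∷ []) xs
map-as-concatMap f [] = refl
map-as-concatMap f (x ∷ xs) = cong (f x ∷_) (map-as-concatMap f xs)

map-bfilter-map : (f : B → C) (p : B → Bool) (s : A → B) (xs : List A) →
  map f (bfilter p (map s xs)) ≡ concatMap (λ x → guard (p (s x)) (f (s x) ∷ [])) xs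
map-bfilter-map f p s [] = refl
map-bfilter-map f p s (x ∷ xs) with p (s x)
... | true = cong (f (s x) ∷_) (map-bfilter-map f p s xs)
... | false = map-bfilter-map f p s xs

length-bfilter-∨ : (p q r : A → Bool) (xs : List A) →
  (∀ x → x ∈ xs → p x ≡ q x ∨ r x) → (∀ x → x ∈ xs → ¬ (T (q x) × T (r x))) →
  length (bfilter p xs) ≡ length (bfilter q xs) + length (bfilter r xs)
length-bfilter-∨ p q r [] _ _ = refl
length-bfilter-∨ p q r (x ∷ xs) p≡q∨r q∩r≡∅ with p x | q x | r x | p≡q∨r x (here refl) | q∩r≡∅ x (here refl)
  | length-bfilter-∨ p q r xs (λ y y∈ → p≡q∨r y (there y∈)) (λ y y∈ → q∩r≡∅ y (there y∈))
... | true | true | true | _ | disj | _ = ⊥-elim (disj (tt , tt))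
... | true | true | false | _ | _ | ih = cong suc ih
... | true | false | true | _ | _ | ih = trans (cong suc ih) (sym (+-suc _ _))
... | false | false | false | _ | _ | ih = ih

length-bfilter-≡ᵇ : (b₀ B : ℕ) → b₀ < B → length (bfilter (_≡ᵇ b₀) (range0 B)) ≡ 1
length-bfilter-≡ᵇ b₀ (suc B) b₀<1+B rewrite length-bfilter-++ (_≡ᵇ b₀) (range0 B) (B ∷ [])
  with m≤n⇒m<n∨m≡n (s≤s⁻¹ b₀<1+B)
... | inj₁ b₀<B rewrite ¬T-false {B ≡ᵇ b₀} (λ t → <-irrefl (sym (≡ᵇ⇒≡ B b₀ t)) b₀<B) =
  trans (+-identityʳ _) (length-bfilter-≡ᵇ b₀ B b₀<B)
... | inj₂ refl rewrite T-true (≡⇒≡ᵇ b₀ b₀ refl)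
                      | bfilter-none (_≡ᵇ b₀) (range0 b₀) (λ b b∈ t → <-irrefl (≡ᵇ⇒≡ b b₀ t) (∈-range0⁻ b₀ b∈)) = refl

-- Polynomials up to equality of coefficients

module _ {m : ℕ} where

  coeff-++ : (p q : Poly m) (e : Exp m) → coeff (p ++ q) e ≡ coeff p e ℤ.+ coeff q e
  coeff-++ [] q e = sym (ℤP.+-identityˡ _)
  coeff-++ (t ∷ p) q e with eqExp (proj₂ t) e
  ... | true = trans (cong (λ c → proj₁ t ℤ.+ c) (coeff-++ p q e)) (sym (ℤP.+-assoc (proj₁ t) _ _))
  ... | false = coeff-++ p q e

  coeff-⊖ : (p : Poly m) (e : Exp m) → coeff (⊖ p) e ≡ ℤ.- coeff p e
  coeff-⊖ [] e = refl
  coeff-⊖ (t ∷ p) e with eqExp (proj₂ t) e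
  ... | true = trans (cong (λ c → ℤ.- proj₁ t ℤ.+ c) (coeff-⊖ p e)) (sym (ℤP.neg-distrib-+ (proj₁ t) _))
  ... | false = coeff-⊖ p e

  infix 4 _≈_
  record _≈_ (p q : Poly m) : Set where
    constructor mk≈
    field coeffs : p ≈P q
  open _≈_ public

  ≈-refl : {p : Poly m} → p ≈ p
  ≈-refl = mk≈ λ _ → refl

  ≡⇒≈ : {p q : Poly m} → p ≡ q → p ≈ q
  ≡⇒≈ refl = ≈-refl

  ≈-sym : {p q : Poly m} → p ≈ q → q ≈ p
  ≈-sym (mk≈ h) = mk≈ (sym ∘ h)

  ≈-trans : {p q r : Poly m} → p ≈ q → q ≈ r → p ≈ r
  ≈-trans (mk≈ h) (mk≈ g) = mk≈ λ e → trans (h e) (g e)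

  ≈-setoid : Setoid 0ℓ 0ℓ
  ≈-setoid = record
    { Carrier = Poly m ; _≈_ = _≈_
    ; isEquivalence = record { refl = ≈-refl ; sym = ≈-sym ; trans = ≈-trans } }

  ++-cong : {p p' q q' : Poly m} → p ≈ p' → q ≈ q' → p ++ q ≈ p' ++ q'
  ++-cong {p} {p'} {q} {q'} (mk≈ h) (mk≈ g) = mk≈ λ e → begin
    coeff (p ++ q) e            ≡⟨ coeff-++ p q e ⟩
    coeff p e ℤ.+ coeff q e     ≡⟨ cong₂ ℤ._+_ (h e) (g e) ⟩
    coeff p' e ℤ.+ coeff q' e   ≡⟨ coeff-++ p' q' e ⟨
    coeff (p' ++ q') e          ∎
    where open ≡-Reasoning

  ++-comm-≈ : (p q : Poly m) → p ++ q ≈ q ++ p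
  ++-comm-≈ p q = mk≈ λ e → trans (coeff-++ p q e) (trans (ℤP.+-comm (coeff p e) (coeff q e)) (sym (coeff-++ q p e)))

  ++-interchange-≈ : (p q r s : Poly m) → (p ++ q) ++ (r ++ s) ≈ (p ++ r) ++ (q ++ s)
  ++-interchange-≈ p q r s = mk≈ λ e → begin
    coeff ((p ++ q) ++ (r ++ s)) e
      ≡⟨ trans (coeff-++ (p ++ q) (r ++ s) e) (cong₂ ℤ._+_ (coeff-++ p q e) (coeff-++ r s e)) ⟩
    (coeff p e ℤ.+ coeff q e) ℤ.+ (coeff r e ℤ.+ coeff s e)
      ≡⟨ interchange (coeff p e) (coeff q e) (coeff r e) (coeff s e) ⟩
    (coeff p e ℤ.+ coeff r e) ℤ.+ (coeff q e ℤ.+ coeff s e)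
      ≡⟨ trans (coeff-++ (p ++ r) (q ++ s) e) (cong₂ ℤ._+_ (coeff-++ p r e) (coeff-++ q s e)) ⟨
    coeff ((p ++ r) ++ (q ++ s)) e ∎
    where open ≡-Reasoning

  ++-cancelʳ-≈ : (p q r : Poly m) → p ++ r ≈ q ++ r → p ≈ q
  ++-cancelʳ-≈ p q r (mk≈ h) = mk≈ λ e →
    ∙-cancelʳ (coeff r e) (coeff p e) (coeff q e) (trans (sym (coeff-++ p r e)) (trans (h e) (coeff-++ q r e)))

  ↭⇒≈ : {p q : Poly m} → p ↭ q → p ≈ q
  ↭⇒≈ ↭.refl = ≈-refl
  ↭⇒≈ (↭.prep x p↭q) = ++-cong (≈-refl {x ∷ []}) (↭⇒≈ p↭q)
  ↭⇒≈ (↭.swap x y p↭q) = ++-cong (++-comm-≈ (x ∷ []) (y ∷ [])) (↭⇒≈ p↭q)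
  ↭⇒≈ (↭.trans p↭q q↭r) = ≈-trans (↭⇒≈ p↭q) (↭⇒≈ q↭r)

  concatMap-cong-≈ : (f g : A → Poly m) (xs : List A) → (∀ x → x ∈ xs → f x ≈ g x) → concatMap f xs ≈ concatMap g xs
  concatMap-cong-≈ f g [] h = ≈-refl
  concatMap-cong-≈ f g (x ∷ xs) h = ++-cong (h x (here refl)) (concatMap-cong-≈ f g xs (λ y y∈ → h y (there y∈)))

  concatMap-++-≈ : (f g : A → Poly m) (xs : List A) → concatMap (λ x → f x ++ g x) xs ≈ concatMap f xs ++ concatMap g xs
  concatMap-++-≈ f g [] = ≈-refl
  concatMap-++-≈ f g (x ∷ xs) = ≈-trans (++-cong (≈-refl {f x ++ g x}) (concatMap-++-≈ f g xs)) (++-interchange-≈ (f x) (g x) _ _)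

  concatMap-comm-≈ : (f : A → B → Poly m) (xs : List A) (ys : List B) →
    concatMap (λ x → concatMap (f x) ys) xs ≈ concatMap (λ y → concatMap (λ x → f x y) xs) ys
  concatMap-comm-≈ f [] ys = ≡⇒≈ (sym (concatMap-[] (λ _ → []) ys (λ _ _ → refl)))
  concatMap-comm-≈ f (x ∷ xs) ys = ≈-trans (++-cong (≈-refl {concatMap (f x) ys}) (concatMap-comm-≈ f xs ys))
    (≈-sym (concatMap-++-≈ (f x) (λ y → concatMap (λ x → f x y) xs) ys))

  guard-∨ : (p q r : Bool) (l : Poly m) → p ≡ q ∨ r → ¬ (T q × T r) → guard p l ≈ guard q l ++ guard r l
  guard-∨ .(true ∨ r) true r l refl h with r
  ... | true = ⊥-elim (h (tt , tt))
  ... | false = ≡⇒≈ (sym (LP.++-identityʳ l))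
  guard-∨ .(false ∨ r) false r l refl h = ≈-refl

  concatMap-guard-∨ : (p q r : A → Bool) (f : A → Poly m) (xs : List A) →
    (∀ x → x ∈ xs → p x ≡ q x ∨ r x) → (∀ x → x ∈ xs → ¬ (T (q x) × T (r x))) →
    concatMap (λ x → guard (p x) (f x)) xs ≈ concatMap (λ x → guard (q x) (f x)) xs ++ concatMap (λ x → guard (r x) (f x)) xs
  concatMap-guard-∨ p q r f xs p≡q∨r q∩r≡∅ = ≈-trans
    (concatMap-cong-≈ _ (λ x → guard (q x) (f x) ++ guard (r x) (f x)) xs
      (λ x x∈ → guard-∨ (p x) (q x) (r x) (f x) (p≡q∨r x x∈) (q∩r≡∅ x x∈)))
    (concatMap-++-≈ _ _ xs)

  ++-cancelˡ-≈ : (p q r : Poly m) → r ++ p ≈ r ++ q → p ≈ q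
  ++-cancelˡ-≈ p q r h = ++-cancelʳ-≈ p q r (≈-trans (++-comm-≈ p r) (≈-trans h (++-comm-≈ r q)))

  concatMap-guard-≡ᵇ : (f : ℕ → Poly m) (b₀ B : ℕ) → b₀ < B → concatMap (λ b → guard (b ≡ᵇ b₀) (f b)) (range0 B) ≈ f b₀
  concatMap-guard-≡ᵇ f b₀ (suc B) b₀<1+B rewrite LP.concatMap-++ (λ b → guard (b ≡ᵇ b₀) (f b)) (range0 B) (B ∷ [])
    with m≤n⇒m<n∨m≡n (s≤s⁻¹ b₀<1+B)
  ... | inj₁ b₀<B rewrite ¬T-false {B ≡ᵇ b₀} (λ t → <-irrefl (sym (≡ᵇ⇒≡ B b₀ t)) b₀<B) =
    ≈-trans (≡⇒≈ (LP.++-identityʳ _)) (concatMap-guard-≡ᵇ f b₀ B b₀<B)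
  ... | inj₂ refl rewrite T-true (≡⇒≡ᵇ b₀ b₀ refl) = ≡⇒≈ (begin
    concatMap (λ b → guard (b ≡ᵇ b₀) (f b)) (range0 b₀) ++ f b₀ ++ []
      ≡⟨ cong (_++ f b₀ ++ []) (concatMap-[] _ (range0 b₀)
           (λ b b∈ → cong (λ c → guard c (f b)) (¬T-false (λ t → <-irrefl (≡ᵇ⇒≡ b b₀ t) (∈-range0⁻ b₀ b∈))))) ⟩
    f b₀ ++ []
      ≡⟨ LP.++-identityʳ (f b₀) ⟩
    f b₀ ∎)
    where open ≡-Reasoning

  ++-⊖-≈ : (a b c d : Poly m) → a ++ d ≈ c ++ b → b ++ ⊖ a ≈ d ++ ⊖ c
  ++-⊖-≈ a b c d (mk≈ h) = mk≈ λ e → begin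
    coeff (b ++ ⊖ a) e                  ≡⟨ coeff-minus b a e ⟩
    β e ℤ.+ ℤ.- α e                     ≡⟨ cancel-γ (α e) (β e) (γ e) ⟩
    ((γ e ℤ.+ β e) ℤ.+ ℤ.- α e) ℤ.+ ℤ.- γ e
      ≡⟨ cong (λ x → (x ℤ.+ ℤ.- α e) ℤ.+ ℤ.- γ e) (trans (sym (coeff-++ c b e)) (trans (sym (h e)) (coeff-++ a d e))) ⟩
    ((α e ℤ.+ δ e) ℤ.+ ℤ.- α e) ℤ.+ ℤ.- γ e
                                        ≡⟨ cancel-α (α e) (γ e) (δ e) ⟩
    δ e ℤ.+ ℤ.- γ e                     ≡⟨ coeff-minus d c e ⟨
    coeff (d ++ ⊖ c) e                  ∎
    where
    open ≡-Reasoning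
    α β γ δ : Exp m → ℤ
    α = coeff a
    β = coeff b
    γ = coeff c
    δ = coeff d
    coeff-minus : (p q : Poly m) (e : Exp m) → coeff (p ++ ⊖ q) e ≡ coeff p e ℤ.+ ℤ.- coeff q e
    coeff-minus p q e = trans (coeff-++ p (⊖ q) e) (cong (λ x → coeff p e ℤ.+ x) (coeff-⊖ q e))
    cancel-γ : ∀ a b c → b ℤ.+ ℤ.- a ≡ ((c ℤ.+ b) ℤ.+ ℤ.- a) ℤ.+ ℤ.- c
    cancel-γ = solve-∀
    cancel-α : ∀ a c d → ((a ℤ.+ d) ℤ.+ ℤ.- a) ℤ.+ ℤ.- c ≡ d ℤ.+ ℤ.- c
    cancel-α = solve-∀

  upFrom-telescope : (E : ℕ → Exp m) (lo k : ℕ) →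
    map (λ i → (+ 1 , E (suc i))) (upFrom lo k) ++ map (λ i → (-[1+ 0 ] , E i)) (upFrom lo k)
      ≈ (+ 1 , E (lo + k)) ∷ (-[1+ 0 ] , E lo) ∷ []
  upFrom-telescope E lo k = subst₂ (λ b ⊖a → b ++ ⊖a ≈ (+ 1 , E (lo + k)) ∷ (-[1+ 0 ] , E lo) ∷ [])
    (shift lo k) (sym (LP.map-∘ (upFrom lo k)))
    (++-⊖-≈ (S lo k) (S (suc lo) k) ((+ 1 , E lo) ∷ []) ((+ 1 , E (lo + k)) ∷ [])
      (≡⇒≈ (trans (sym (LP.map-++ _ (upFrom lo k) _)) (cong (map (λ i → (+ 1 , E i))) (sym (upFrom-suc lo k))))))
    where
    S : ℕ → ℕ → Poly m
    S lo k = map (λ i → (+ 1 , E i)) (upFrom lo k)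
    shift : ∀ lo k → S (suc lo) k ≡ map (λ i → (+ 1 , E (suc i))) (upFrom lo k)
    shift lo zero = refl
    shift lo (suc k) = cong ((+ 1 , E (suc lo)) ∷_) (shift (suc lo) k)

-- The ranks 1 + #{b' | M b < M b'} of the values M b > t enumerate 1, …, #{b | t < M b}.
module RankSum {m : ℕ} (B n : ℕ) (M : ℕ → ℕ) (M-injective : ∀ a b → a < B → b < B → M a ≡ M b → a ≡ b)
               (M≤n : ∀ b → b < B → M b ≤ n) (φ : ℕ → Poly m) where

  above : ℕ → ℕ
  above t = length (bfilter (λ b → t <ᵇ M b) (range0 B))

  ranks : ℕ → Poly m
  ranks t = concatMap (λ b → guard (t <ᵇ M b) (φ (suc (above (M b))))) (range0 B)

  private
    hit : ∀ {t b₀} → M b₀ ≡ suc t → b₀ < B → ∀ b → b ∈ range0 B → (t <ᵇ M b) ≡ (suc t <ᵇ M b) ∨ (b ≡ᵇ b₀)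
    hit {t} {b₀} Mb₀ b₀<B b b∈ = T-ext to from
      where
      to : T (t <ᵇ M b) → T ((suc t <ᵇ M b) ∨ (b ≡ᵇ b₀))
      to t<Mb with m≤n⇒m<n∨m≡n (<ᵇ⇒< t (M b) t<Mb)
      ... | inj₁ 1+t<Mb = T-∨-inl (<⇒<ᵇ 1+t<Mb)
      ... | inj₂ eq = T-∨-inr {suc t <ᵇ M b} (≡⇒≡ᵇ b b₀ (M-injective b b₀ (∈-range0⁻ B b∈) b₀<B (trans (sym eq) (sym Mb₀))))
      from : T ((suc t <ᵇ M b) ∨ (b ≡ᵇ b₀)) → T (t <ᵇ M b)
      from h with T-∨-elim {suc t <ᵇ M b} h
      ... | inj₁ 1+t<Mb = <⇒<ᵇ (<-trans (n<1+n t) (<ᵇ⇒< (suc t) (M b) 1+t<Mb))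
      ... | inj₂ b≡b₀ rewrite ≡ᵇ⇒≡ b b₀ b≡b₀ | Mb₀ = <⇒<ᵇ (n<1+n t)

    hit-disjoint : ∀ {t b₀} → M b₀ ≡ suc t → ∀ b → b ∈ range0 B → ¬ (T (suc t <ᵇ M b) × T (b ≡ᵇ b₀))
    hit-disjoint {t} {b₀} Mb₀ b _ (1+t<Mb , b≡b₀) rewrite ≡ᵇ⇒≡ b b₀ b≡b₀ | Mb₀ = <-irrefl refl (<ᵇ⇒< (suc t) (suc t) 1+t<Mb)

    miss : ∀ {t} → ¬ T (anyB (λ b → M b ≡ᵇ suc t) (range0 B)) → ∀ b → b ∈ range0 B → (t <ᵇ M b) ≡ (suc t <ᵇ M b)
    miss {t} none b b∈ = T-ext to (λ h → <⇒<ᵇ (<-trans (n<1+n t) (<ᵇ⇒< (suc t) (M b) h)))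
      where
      to : T (t <ᵇ M b) → T (suc t <ᵇ M b)
      to t<Mb with m≤n⇒m<n∨m≡n (<ᵇ⇒< t (M b) t<Mb)
      ... | inj₁ 1+t<Mb = <⇒<ᵇ 1+t<Mb
      ... | inj₂ eq = ⊥-elim (none (anyB⁺ (λ b → M b ≡ᵇ suc t) (range0 B) b∈ (≡⇒≡ᵇ (M b) (suc t) (sym eq))))

    ranks-from : ∀ d t → n ≤ d + t → ranks t ≈ concatMap φ (upFrom 1 (above t))
    ranks-from zero t n≤t = ≡⇒≈ (trans (concatMap-[] _ (range0 B) (λ b b∈ → cong (λ c → guard c (φ (suc (above (M b))))) (¬T-false (none b b∈))))
                                      (cong (λ k → concatMap φ (upFrom 1 k)) (sym (cong length (bfilter-none _ (range0 B) none)))))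
      where
      none : ∀ b → b ∈ range0 B → ¬ T (t <ᵇ M b)
      none b b∈ t<Mb = <⇒≱ (<ᵇ⇒< t (M b) t<Mb) (≤-trans (M≤n b (∈-range0⁻ B b∈)) n≤t)
    ranks-from (suc d) t n≤1+d+t with anyB (λ b → M b ≡ᵇ suc t) (range0 B) in found
    ... | true = begin
      ranks t
        ≈⟨ concatMap-guard-∨ _ _ (_≡ᵇ b₀) _ (range0 B) (hit Mb₀ b₀<B) (hit-disjoint Mb₀) ⟩
      ranks (suc t) ++ concatMap (λ b → guard (b ≡ᵇ b₀) (φ (suc (above (M b))))) (range0 B)
        ≈⟨ ++-cong (ranks-from d (suc t) n≤d+1+t) (concatMap-guard-≡ᵇ (λ b → φ (suc (above (M b)))) b₀ B b₀<B) ⟩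
      concatMap φ (upFrom 1 (above (suc t))) ++ φ (suc (above (M b₀)))
        ≡⟨ cong (λ x → concatMap φ (upFrom 1 (above (suc t))) ++ φ (suc (above x))) Mb₀ ⟩
      concatMap φ (upFrom 1 (above (suc t))) ++ φ (suc (above (suc t)))
        ≡⟨ cong (concatMap φ (upFrom 1 (above (suc t))) ++_) (sym (LP.++-identityʳ _)) ⟩
      concatMap φ (upFrom 1 (above (suc t))) ++ concatMap φ (upFrom (1 + above (suc t)) 1)
        ≡⟨ trans (cong (concatMap φ) (upFrom-+ 1 (above (suc t)) 1)) (LP.concatMap-++ φ (upFrom 1 (above (suc t))) _) ⟨
      concatMap φ (upFrom 1 (above (suc t) + 1))
        ≡⟨ cong (λ k → concatMap φ (upFrom 1 k)) above-t ⟨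
      concatMap φ (upFrom 1 (above t)) ∎
      where
      open SetoidReasoning ≈-setoid
      n≤d+1+t = subst (n ≤_) (sym (+-suc d t)) n≤1+d+t
      witness = anyB⁻ (λ b → M b ≡ᵇ suc t) (range0 B) (subst T (sym found) tt)
      b₀ = proj₁ witness
      b₀<B = ∈-range0⁻ B (proj₁ (proj₂ witness))
      Mb₀ = ≡ᵇ⇒≡ (M b₀) (suc t) (proj₂ (proj₂ witness))
      above-t : above t ≡ above (suc t) + 1
      above-t = trans (length-bfilter-∨ _ _ _ (range0 B) (hit Mb₀ b₀<B) (hit-disjoint Mb₀))
                      (cong (λ x → above (suc t) + x) (length-bfilter-≡ᵇ b₀ B b₀<B))
    ... | false = subst (λ k → ranks t ≈ concatMap φ (upFrom 1 k)) (sym same-above)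
                        (≈-trans (≡⇒≈ same-ranks) (ranks-from d (suc t) (subst (n ≤_) (sym (+-suc d t)) n≤1+d+t)))
      where
      unchanged = miss {t} (λ h → subst T found h)
      same-ranks : ranks t ≡ ranks (suc t)
      same-ranks = concatMap-cong-∈ _ _ (range0 B) (λ b b∈ → cong (λ c → guard c (φ (suc (above (M b))))) (unchanged b b∈))
      same-above : above t ≡ above (suc t)
      same-above = cong length (bfilter-cong _ _ (range0 B) unchanged)

  rank-sum : ∀ t → ranks t ≈ concatMap φ (upFrom 1 (above t))
  rank-sum t = ranks-from n t (m≤m+n n t)

  ranks-between : ∀ {t t'} → t ≤ t' →
    concatMap (λ b → guard ((t <ᵇ M b) ∧ not (t' <ᵇ M b)) (φ (suc (above (M b))))) (range0 B)
      ≈ concatMap φ (upFrom (suc (above t')) (above t ∸ above t'))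
  ranks-between {t} {t'} t≤t' = ++-cancelˡ-≈ D X (ranks t') (begin
    ranks t' ++ D                                              ≈⟨ concatMap-guard-∨ _ _ _ _ (range0 B) split disjoint ⟨
    ranks t                                                    ≈⟨ rank-sum t ⟩
    concatMap φ (upFrom 1 (above t))                           ≡⟨ cong (λ k → concatMap φ (upFrom 1 k)) (sym (m+[n∸m]≡n above-t'≤)) ⟩
    concatMap φ (upFrom 1 (above t' + (above t ∸ above t')))   ≡⟨ trans (cong (concatMap φ) (upFrom-+ 1 (above t') _)) (LP.concatMap-++ φ (upFrom 1 (above t')) _) ⟩
    concatMap φ (upFrom 1 (above t')) ++ X                     ≈⟨ ++-cong (rank-sum t') ≈-refl ⟨
    ranks t' ++ X                                              ∎)
    where
    open SetoidReasoning ≈-setoid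
    D = concatMap (λ b → guard ((t <ᵇ M b) ∧ not (t' <ᵇ M b)) (φ (suc (above (M b))))) (range0 B)
    X = concatMap φ (upFrom (suc (above t')) (above t ∸ above t'))
    t'<⇒t< : ∀ b → T (t' <ᵇ M b) → T (t <ᵇ M b)
    t'<⇒t< b h = <⇒<ᵇ (≤-<-trans t≤t' (<ᵇ⇒< t' (M b) h))
    split : ∀ b → b ∈ range0 B → (t <ᵇ M b) ≡ (t' <ᵇ M b) ∨ ((t <ᵇ M b) ∧ not (t' <ᵇ M b))
    split b _ = split-implied (t <ᵇ M b) (t' <ᵇ M b) (t'<⇒t< b)
    disjoint : ∀ b → b ∈ range0 B → ¬ (T (t' <ᵇ M b) × T ((t <ᵇ M b) ∧ not (t' <ᵇ M b)))
    disjoint b _ = split-implied-disjoint (t <ᵇ M b) (t' <ᵇ M b)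
    above-t'≤ : above t' ≤ above t
    above-t'≤ = subst (above t' ≤_) (sym (length-bfilter-∨ _ _ _ (range0 B) split disjoint)) (m≤m+n _ _)

-- Exponent vectors (getE and setE index from 1)

getE-ext : ∀ {m} (e e' : Exp m) → (∀ i → 1 ≤ i → i ≤ m → getE e i ≡ getE e' i) → e ≡ e'
getE-ext [] [] h = refl
getE-ext (x ∷ xs) (y ∷ ys) h =
  cong₂ _∷_ (h 1 (s≤s z≤n) (s≤s z≤n)) (getE-ext xs ys (λ { (suc i) _ (s≤s i≤m) → h (suc (suc i)) (s≤s z≤n) (s≤s (s≤s i≤m)) }))

getE-addE : ∀ {m} (e f : Exp m) i → getE (addE e f) i ≡ getE e i + getE f i
getE-addE [] [] i = refl
getE-addE (x ∷ xs) (y ∷ ys) zero = refl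
getE-addE (x ∷ xs) (y ∷ ys) (suc zero) = refl
getE-addE (x ∷ xs) (y ∷ ys) (suc (suc i)) = getE-addE xs ys (suc i)

getE-setE-≡ : ∀ {m} (e : Exp m) j v → 1 ≤ j → j ≤ m → getE (setE e j v) j ≡ v
getE-setE-≡ (x ∷ xs) (suc zero) v _ _ = refl
getE-setE-≡ (x ∷ xs) (suc (suc j)) v _ (s≤s j≤m) = getE-setE-≡ xs (suc j) v (s≤s z≤n) j≤m

getE-setE-≢ : ∀ {m} (e : Exp m) j v i → i ≢ j → getE (setE e j v) i ≡ getE e i
getE-setE-≢ [] j v i i≢j = refl
getE-setE-≢ (x ∷ xs) zero v i i≢j = refl
getE-setE-≢ (x ∷ xs) (suc zero) v zero i≢j = refl
getE-setE-≢ (x ∷ xs) (suc zero) v (suc zero) i≢j = ⊥-elim (i≢j refl)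
getE-setE-≢ (x ∷ xs) (suc zero) v (suc (suc i)) i≢j = refl
getE-setE-≢ (x ∷ xs) (suc (suc j)) v zero i≢j = refl
getE-setE-≢ (x ∷ xs) (suc (suc j)) v (suc zero) i≢j = refl
getE-setE-≢ (x ∷ xs) (suc (suc j)) v (suc (suc i)) i≢j = getE-setE-≢ xs (suc j) v (suc i) (i≢j ∘ cong suc)

setE-getE : ∀ {m} (e : Exp m) j → setE e j (getE e j) ≡ e
setE-getE [] j = refl
setE-getE (x ∷ xs) zero = refl
setE-getE (x ∷ xs) (suc zero) = refl
setE-getE (x ∷ xs) (suc (suc j)) = cong (x ∷_) (setE-getE xs (suc j))

getE-tabulate : ∀ {m} (g : ℕ → ℕ) i → 1 ≤ i → i ≤ m → getE (tabulate {n = m} (λ j → g (suc (toℕ j)))) i ≡ g i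
getE-tabulate {suc m} g (suc zero) _ _ = refl
getE-tabulate {suc m} g (suc (suc i)) _ (s≤s i≤m) = getE-tabulate {m} (g ∘ suc) (suc i) (s≤s z≤n) i≤m

getE-zeroE : ∀ {m} i → getE (zeroE m) i ≡ 0
getE-zeroE {zero} i = refl
getE-zeroE {suc m} zero = refl
getE-zeroE {suc m} (suc zero) = refl
getE-zeroE {suc m} (suc (suc i)) = getE-zeroE {m} (suc i)

addE-identityˡ : ∀ {m} (e : Exp m) → addE (zeroE m) e ≡ e
addE-identityˡ {m} e = getE-ext _ _ (λ i _ _ → trans (getE-addE (zeroE m) e i) (cong (_+ getE e i) (getE-zeroE {m} i)))

unitE : (m j : ℕ) → Exp m
unitE m j = setE (zeroE m) j 1

addE-unitE-setE : ∀ {m} (e : Exp m) j v → 1 ≤ j → j ≤ m → addE (unitE m j) (setE e j v) ≡ setE e j (suc v)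
addE-unitE-setE {m} e j v 1≤j j≤m = getE-ext _ _ λ i _ _ → trans (getE-addE (unitE m j) (setE e j v) i) (coordinate i)
  where
  coordinate : ∀ i → getE (unitE m j) i + getE (setE e j v) i ≡ getE (setE e j (suc v)) i
  coordinate i with i ≟ j
  ... | yes refl = trans (cong₂ _+_ (getE-setE-≡ (zeroE m) i 1 1≤j j≤m) (getE-setE-≡ e i v 1≤j j≤m)) (sym (getE-setE-≡ e i (suc v) 1≤j j≤m))
  ... | no i≢j = trans (cong₂ _+_ (trans (getE-setE-≢ (zeroE m) j 1 i i≢j) (getE-zeroE {m} i)) (getE-setE-≢ e j v i i≢j))
                       (sym (getE-setE-≢ e j (suc v) i i≢j))

onesUpTo : (m k : ℕ) → Exp m
onesUpTo m k = tabulate (λ (i : Fin m) → if suc (toℕ i) ≤ᵇ k then 1 else 0)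

getE-onesUpTo : ∀ m k i → 1 ≤ i → i ≤ m → getE (onesUpTo m k) i ≡ (if i ≤ᵇ k then 1 else 0)
getE-onesUpTo m k = getE-tabulate {m} (λ i → if i ≤ᵇ k then 1 else 0)

getE-unitE-1 : ∀ m i → 1 ≤ i → i ≤ m → getE (unitE m 1) i ≡ (if i ≤ᵇ 1 then 1 else 0)
getE-unitE-1 m (suc zero) _ i≤m = getE-setE-≡ (zeroE m) 1 1 (s≤s z≤n) i≤m
getE-unitE-1 m (suc (suc i)) _ _ = trans (getE-setE-≢ (zeroE m) 1 1 (suc (suc i)) (λ ())) (getE-zeroE {m} (suc (suc i)))

getE-aVec : ∀ m π i → 1 ≤ i → i ≤ m → getE (aVec m π) i ≡ aStat i π
getE-aVec m π = getE-tabulate {m} (λ k → aStat k π)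

-- Arcs, nestings and block maxima

ground-∈⁻ : ∀ π {i} → i ∈ ground π → 1 ≤ i × i ≤ length π
ground-∈⁻ π = ∈-rangeFT⁻ 1 (length π)

ground-∈⁺ : ∀ π {i} → 1 ≤ i → i ≤ length π → i ∈ ground π
ground-∈⁺ π = ∈-rangeFT⁺ 1 (length π)

labelAt-++ : ∀ (π : List ℕ) x i → 1 ≤ i → i ≤ length π → labelAt (π ++ x ∷ []) i ≡ labelAt π i
labelAt-++ (y ∷ π) x (suc zero) _ _ = refl
labelAt-++ (y ∷ π) x (suc (suc i)) _ (s≤s i≤n) = labelAt-++ π x (suc i) (s≤s z≤n) i≤n

labelAt-last : ∀ (π : List ℕ) x → labelAt (π ++ x ∷ []) (suc (length π)) ≡ x
labelAt-last [] x = refl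
labelAt-last (y ∷ π) x = labelAt-last π x

length-∷ʳ : (xs : List A) (x : A) → length (xs ++ x ∷ []) ≡ suc (length xs)
length-∷ʳ xs x = trans (LP.length-++ xs) (+-comm (length xs) 1)

record IsArc (π : Partition) (i j : ℕ) : Set where
  constructor mkArc
  field
    1≤start : 1 ≤ i
    end≤n : j ≤ length π
    start<end : i < j
    same-label : labelAt π i ≡ labelAt π j
    consecutive : ∀ k → i < k → k < j → labelAt π i ≢ labelAt π k
open IsArc public

isArc⇒IsArc : ∀ π i j → i ∈ ground π → j ∈ ground π → T (isArc π i j) → IsArc π i j
isArc⇒IsArc π i j i∈ j∈ h = mkArc 1≤i j≤n i<j (≡ᵇ⇒≡ _ _ (T-∧-fst (T-∧-snd {i <ᵇ j} h)))
  (λ k i<k k<j eq → T-not⁻ (allB⁻ _ (ground π) (T-∧-snd {sameBlock π i j} (T-∧-snd {i <ᵇ j} h))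
      (ground-∈⁺ π (≤-trans 1≤i (<⇒≤ i<k)) (≤-trans (<⇒≤ k<j) j≤n)))
    (T-∧-intro (<⇒<ᵇ i<k) (T-∧-intro (<⇒<ᵇ k<j) (≡⇒≡ᵇ _ _ eq))))
  where
  1≤i = proj₁ (ground-∈⁻ π i∈)
  j≤n = proj₂ (ground-∈⁻ π j∈)
  i<j = <ᵇ⇒< i j (T-∧-fst h)

IsArc⇒isArc : ∀ π i j → IsArc π i j → T (isArc π i j)
IsArc⇒isArc π i j (mkArc _ _ i<j same between) = T-∧-intro (<⇒<ᵇ i<j) (T-∧-intro (≡⇒≡ᵇ _ _ same) (allB⁺ _ (ground π) λ {k} _ →
  T-not⁺ (λ t → between k (<ᵇ⇒< i k (T-∧-fst t)) (<ᵇ⇒< k j (T-∧-fst (T-∧-snd {i <ᵇ k} t)))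
    (≡ᵇ⇒≡ _ _ (T-∧-snd {k <ᵇ j} (T-∧-snd {i <ᵇ k} t))))))

∈-arcs⁻ : ∀ π {a} → a ∈ arcs π → IsArc π (proj₁ a) (proj₂ a)
∈-arcs⁻ π h with find (∈-concatMap⁻ _ {xs = ground π} h)
... | i , i∈ , a∈ with ∈-map⁻ (i ,_) a∈
... | j , j∈ , refl = let (j∈′ , t) = ∈-bfilter⁻ _ (ground π) j∈ in isArc⇒IsArc π i j i∈ j∈′ t

∈-arcs⁺ : ∀ π {i j} → IsArc π i j → (i , j) ∈ arcs π
∈-arcs⁺ π {i} {j} arc = ∈-concatMap⁺ _ {xs = ground π}
  (lose i∈ (∈-map⁺ (i ,_) (∈-bfilter⁺ _ (ground π) j∈ (IsArc⇒isArc π i j arc))))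
  where
  i∈ = ground-∈⁺ π (1≤start arc) (≤-trans (<⇒≤ (start<end arc)) (end≤n arc))
  j∈ = ground-∈⁺ π (≤-trans (1≤start arc) (<⇒≤ (start<end arc))) (end≤n arc)

record IsBlockMax (π : Partition) (x i : ℕ) : Set where
  constructor mkMax
  field
    1≤max : 1 ≤ i
    max≤n : i ≤ length π
    max-label : labelAt π i ≡ x
    above-max : ∀ k → i < k → k ≤ length π → labelAt π k ≢ x
open IsBlockMax public

IsBlockMax-unique : ∀ π {x i i'} → IsBlockMax π x i → IsBlockMax π x i' → i ≡ i'
IsBlockMax-unique π {x} {i} {i'} h g with <-cmp i i'
... | tri< i<i' _ _ = ⊥-elim (above-max h i' i<i' (max≤n g) (max-label g))
... | tri≈ _ eq _ = eq
... | tri> _ _ i'<i = ⊥-elim (above-max g i i'<i (max≤n h) (max-label h))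

∈-tuples⁻ : (k : ℕ) (xs : List A) {t : List A} → t ∈ tuples k xs → length t ≡ k × All (_∈ xs) t
∈-tuples⁻ zero xs (here refl) = refl , []
∈-tuples⁻ (suc k) xs h with find (∈-concatMap⁻ _ {xs = xs} h)
... | a , a∈ , t∈ with ∈-map⁻ (a ∷_) t∈
... | t , t∈′ , refl = let (len , all) = ∈-tuples⁻ k xs t∈′ in cong suc len , (a∈ ∷ all)

∈-tuples⁺ : (xs : List A) {t : List A} → All (_∈ xs) t → t ∈ tuples (length t) xs
∈-tuples⁺ xs [] = here refl
∈-tuples⁺ xs {a ∷ t} (a∈ ∷ all) = ∈-concatMap⁺ _ {xs = xs} (lose a∈ (∈-map⁺ (a ∷_) (∈-tuples⁺ xs all)))

Encloses : Arc → List Arc → Set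
Encloses a [] = ⊤
Encloses a (b ∷ N) = proj₁ a < proj₁ b × proj₂ b < proj₂ a

chain-tail : ∀ a N → T (chain (a ∷ N)) → T (chain N)
chain-tail a [] _ = tt
chain-tail a (b ∷ N) h = T-∧-snd {proj₂ b <ᵇ proj₂ a} (T-∧-snd {proj₁ a <ᵇ proj₁ b} h)

chain-head : ∀ a N → T (chain (a ∷ N)) → Encloses a N
chain-head a [] _ = tt
chain-head a (b ∷ N) h = <ᵇ⇒< _ _ (T-∧-fst h) , <ᵇ⇒< _ _ (T-∧-fst (T-∧-snd {proj₁ a <ᵇ proj₁ b} h))

chain-∷ : ∀ a N → Encloses a N → T (chain N) → T (chain (a ∷ N))
chain-∷ a [] _ _ = tt
chain-∷ a (b ∷ N) (a₁<b₁ , b₂<a₂) h = T-∧-intro (<⇒<ᵇ a₁<b₁) (T-∧-intro (<⇒<ᵇ b₂<a₂) h)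

chain-ends-below : ∀ a N → T (chain (a ∷ N)) → All (λ b → proj₂ b < proj₂ a) N
chain-ends-below a [] _ = []
chain-ends-below a (b ∷ N) h = b₂<a₂ ∷ All.map (λ c₂<b₂ → <-trans c₂<b₂ b₂<a₂) (chain-ends-below b N (chain-tail a (b ∷ N) h))
  where b₂<a₂ = proj₂ (chain-head a (b ∷ N) h)

AllArcs : Partition → List Arc → Set
AllArcs π = All (λ a → IsArc π (proj₁ a) (proj₂ a))

record IsNesting (π : Partition) (k : ℕ) (N : List Arc) : Set where
  constructor mkNesting
  field
    size≡ : length N ≡ k
    all-arcs : AllArcs π N
    nested : T (chain N)
open IsNesting public

∈-nestings⁻ : ∀ π k {N} → N ∈ nestings k π → IsNesting π k N
∈-nestings⁻ π k h = let (N∈ , c) = ∈-bfilter⁻ chain _ h ; (len , all) = ∈-tuples⁻ k (arcs π) N∈ in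
  mkNesting len (All.map (∈-arcs⁻ π) all) c

∈-nestings⁺ : ∀ π k {N} → IsNesting π k N → N ∈ nestings k π
∈-nestings⁺ π k (mkNesting refl all c) = ∈-bfilter⁺ chain _ (∈-tuples⁺ (arcs π) (All.map (∈-arcs⁺ π) all)) c

hasNesting⁻ : ∀ π k → T (hasNesting k π) → ∃[ N ] IsNesting π k N
hasNesting⁻ π k h = let (N , N∈ , _) = anyB⁻ _ (nestings k π) h in N , ∈-nestings⁻ π k N∈

hasNesting⁺ : ∀ π k {N} → IsNesting π k N → T (hasNesting k π)
hasNesting⁺ π k h = anyB⁺ _ (nestings k π) (∈-nestings⁺ π k h) tt

¬hasNesting⇒nestings≡[] : ∀ π k → ¬ T (hasNesting k π) → nestings k π ≡ []
¬hasNesting⇒nestings≡[] π k h with nestings k π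
... | [] = refl
... | _ ∷ _ = ⊥-elim (h tt)

-- the vertex v in the definition of a_k (0 if π has no k-nesting)
maxStart : ℕ → Partition → ℕ
maxStart k π = maxL (map smallestVertex (nestings k π))

maxStart-ub : ∀ π k {N} → IsNesting π k N → smallestVertex N ≤ maxStart k π
maxStart-ub π k h = maxL-ub _ (∈-map⁺ smallestVertex (∈-nestings⁺ π k h))

maxStart-lub : ∀ π k {y} → (∀ N → IsNesting π k N → smallestVertex N ≤ y) → maxStart k π ≤ y
maxStart-lub π k h = maxL-lub _ λ v∈ → let (N , N∈ , eq) = ∈-map⁻ smallestVertex v∈ in
  subst (_≤ _) (sym eq) (h N (∈-nestings⁻ π k N∈))

maxStart-attained : ∀ π k → maxStart k π ≡ 0 ⊎ ∃[ N ] IsNesting π k N × smallestVertex N ≡ maxStart k π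
maxStart-attained π k with maxL-∈ (map smallestVertex (nestings k π))
... | inj₁ none = inj₁ none
... | inj₂ v∈ = let (N , N∈ , eq) = ∈-map⁻ smallestVertex v∈ in inj₂ (N , ∈-nestings⁻ π k N∈ , sym eq)

maxStart≤length : ∀ π k → maxStart k π ≤ length π
maxStart≤length π k = maxStart-lub π k bound
  where
  bound : ∀ N → IsNesting π k N → smallestVertex N ≤ length π
  bound [] _ = z≤n
  bound (a ∷ N) (mkNesting _ (arc ∷ _) _) = ≤-trans (<⇒≤ (start<end arc)) (end≤n arc)

maxStart-suc : ∀ π k → 1 ≤ k → maxStart (suc k) π ≤ maxStart k π
maxStart-suc π k 1≤k = maxStart-lub π (suc k) bound
  where
  bound : ∀ N → IsNesting π (suc k) N → smallestVertex N ≤ maxStart k π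
  bound (a ∷ []) (mkNesting len _ _) with subst (1 ≤_) (sym (suc-injective len)) 1≤k
  ... | ()
  bound (a ∷ b ∷ N) (mkNesting len (_ ∷ arcs) c) = ≤-trans (<⇒≤ (proj₁ (chain-head a (b ∷ N) c)))
    (maxStart-ub π k (mkNesting (suc-injective len) arcs (chain-tail a (b ∷ N) c)))

maxStart-anti : ∀ π {k l} → 1 ≤ k → k ≤ l → maxStart l π ≤ maxStart k π
maxStart-anti π {k} {l} 1≤k k≤l = subst (λ i → maxStart i π ≤ maxStart k π) (m+[n∸m]≡n k≤l) (go (l ∸ k))
  where
  go : ∀ d → maxStart (k + d) π ≤ maxStart k π
  go zero = ≤-reflexive (cong (λ i → maxStart i π) (+-identityʳ k))
  go (suc d) = ≤-trans (≤-reflexive (cong (λ i → maxStart i π) (+-suc k d)))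
                       (≤-trans (maxStart-suc π (k + d) (≤-trans 1≤k (m≤m+n k d))) (go d))

-- the smallest vertex of a nesting opens an arc, so it is never the last element of a block
maxStart≢blockMax : ∀ π k {x M} → IsBlockMax π x M → maxStart k π ≢ M
maxStart≢blockMax π k {x} {M} mx eq with maxStart-attained π k
... | inj₁ none = <-irrefl refl (subst (1 ≤_) (trans (sym eq) none) (1≤max mx))
... | inj₂ ([] , _ , start) = <-irrefl refl (subst (1 ≤_) (trans (sym eq) (sym start)) (1≤max mx))
... | inj₂ ((i , j) ∷ N , mkNesting _ (arc ∷ _) _ , start) =
  above-max mx j (subst (_< j) (trans start eq) (start<end arc)) (end≤n arc)
    (trans (sym (same-label arc)) (trans (cong (labelAt π) (trans start eq)) (max-label mx)))

StartsAfter : ℕ → List Arc → Set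
StartsAfter M [] = ⊤
StartsAfter M (a ∷ N) = M < proj₁ a

-- some k-nesting of π starts after M (for k = 0 the empty one)
FitsAfter : Partition → ℕ → ℕ → Set
FitsAfter π M k = k ≡ 0 ⊎ M < maxStart k π

nesting⇒FitsAfter : ∀ π {M k N} → IsNesting π k N → StartsAfter M N → FitsAfter π M k
nesting⇒FitsAfter π {k = zero} _ _ = inj₁ refl
nesting⇒FitsAfter π {k = suc k} {[]} (mkNesting () _ _) _
nesting⇒FitsAfter π {k = suc k} {a ∷ N} h M<a = inj₂ (<-≤-trans M<a (maxStart-ub π (suc k) h))

FitsAfter⇒nesting : ∀ π {M k} → FitsAfter π M k → ∃[ N ] IsNesting π k N × StartsAfter M N
FitsAfter⇒nesting π {k = zero} _ = [] , mkNesting refl [] tt , tt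
FitsAfter⇒nesting π {M} {suc k} (inj₂ M<max) with maxStart-attained π (suc k)
... | inj₁ none = ⊥-elim (<⇒≱ M<max (≤-trans (≤-reflexive none) z≤n))
... | inj₂ ([] , _ , start) = ⊥-elim (<⇒≱ M<max (≤-trans (≤-reflexive (sym start)) z≤n))
... | inj₂ (a ∷ N , h , start) = a ∷ N , h , subst (M <_) (sym start) M<max

-- Restricted growth strings: the block labels are 0, 1, …, nblocks π - 1

labelBound : ℕ → List ℕ → ℕ
labelBound b [] = b
labelBound b (x ∷ xs) = labelBound (b ⊔ suc x) xs

nblocks : Partition → ℕ
nblocks = labelBound 0

rgsFrom-∷ʳ : ∀ b xs x → rgsFrom b (xs ++ x ∷ []) ≡ rgsFrom b xs ∧ (x ≤ᵇ labelBound b xs)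
rgsFrom-∷ʳ b [] x with x ≤ᵇ b
... | true = refl
... | false = refl
rgsFrom-∷ʳ b (y ∷ xs) x with y ≤ᵇ b
... | true = rgsFrom-∷ʳ (b ⊔ suc y) xs x
... | false = refl

labelBound-∷ʳ : ∀ b xs x → labelBound b (xs ++ x ∷ []) ≡ labelBound b xs ⊔ suc x
labelBound-∷ʳ b [] x = refl
labelBound-∷ʳ b (y ∷ xs) x = labelBound-∷ʳ (b ⊔ suc y) xs x

labelBound-≥ : ∀ b xs → b ≤ labelBound b xs
labelBound-≥ b [] = ≤-refl
labelBound-≥ b (y ∷ xs) = ≤-trans (m≤m⊔n b (suc y)) (labelBound-≥ (b ⊔ suc y) xs)

∈⇒<labelBound : ∀ b xs {y} → y ∈ xs → y < labelBound b xs
∈⇒<labelBound b (z ∷ xs) (here refl) = <-≤-trans (≤-trans (n<1+n z) (m≤n⊔m b (suc z))) (labelBound-≥ _ xs)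
∈⇒<labelBound b (z ∷ xs) (there y∈) = ∈⇒<labelBound (b ⊔ suc z) xs y∈

<labelBound⇒∈ : ∀ b xs → T (rgsFrom b xs) → ∀ {y} → y < labelBound b xs → y < b ⊎ y ∈ xs
<labelBound⇒∈ b [] _ y<b = inj₁ y<b
<labelBound⇒∈ b (z ∷ xs) h {y} y<bound with <labelBound⇒∈ (b ⊔ suc z) xs (T-∧-snd {z ≤ᵇ b} h) y<bound
... | inj₂ y∈ = inj₂ (there y∈)
... | inj₁ y<b⊔1+z with ⊔-sel b (suc z)
...   | inj₁ eq = inj₁ (subst (y <_) eq y<b⊔1+z)
...   | inj₂ eq with m≤n⇒m<n∨m≡n (s≤s⁻¹ (subst (y <_) eq y<b⊔1+z))
...     | inj₂ refl = inj₂ (here refl)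
...     | inj₁ y<z = inj₁ (<-≤-trans y<z (≤ᵇ⇒≤ z b (T-∧-fst h)))

labelBound≤ : ∀ b xs → T (rgsFrom b xs) → labelBound b xs ≤ b + length xs
labelBound≤ b [] _ = ≤-reflexive (sym (+-identityʳ b))
labelBound≤ b (z ∷ xs) h = ≤-trans (labelBound≤ (b ⊔ suc z) xs (T-∧-snd {z ≤ᵇ b} h))
  (≤-trans (+-monoˡ-≤ (length xs) (⊔-lub (n≤1+n b) (s≤s (≤ᵇ⇒≤ z b (T-∧-fst h))))) (≤-reflexive (sym (+-suc b (length xs)))))

Occurs : Partition → ℕ → Set
Occurs π y = ∃[ i ] 1 ≤ i × i ≤ length π × labelAt π i ≡ y

∈⇒Occurs : ∀ π {y} → y ∈ π → Occurs π y
∈⇒Occurs (z ∷ π) (here refl) = 1 , s≤s z≤n , s≤s z≤n , refl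
∈⇒Occurs (z ∷ π) (there y∈) with ∈⇒Occurs π y∈
... | suc i , _ , i≤n , eq = suc (suc i) , s≤s z≤n , s≤s i≤n , eq

Occurs⇒∈ : ∀ π {y} → Occurs π y → y ∈ π
Occurs⇒∈ (z ∷ π) (suc zero , _ , _ , refl) = here refl
Occurs⇒∈ (z ∷ π) (suc (suc i) , _ , s≤s i≤n , eq) = there (Occurs⇒∈ π (suc i , s≤s z≤n , i≤n , eq))

<nblocks⇒Occurs : ∀ π → T (isRGS π) → ∀ {y} → y < nblocks π → Occurs π y
<nblocks⇒Occurs π h y< with <labelBound⇒∈ 0 π h y<
... | inj₂ y∈ = ∈⇒Occurs π y∈

Occurs⇒<nblocks : ∀ π {y} → Occurs π y → y < nblocks π
Occurs⇒<nblocks π occ = ∈⇒<labelBound 0 π (Occurs⇒∈ π occ)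

nblocks≤length : ∀ π → T (isRGS π) → nblocks π ≤ length π
nblocks≤length π = labelBound≤ 0 π

bfilter-<ᵇ-range0 : ∀ B n → B ≤ n → bfilter (_<ᵇ B) (range0 n) ≡ range0 B
bfilter-<ᵇ-range0 zero zero _ = refl
bfilter-<ᵇ-range0 B (suc n) B≤1+n rewrite bfilter-++ (_<ᵇ B) (range0 n) (n ∷ []) with m≤n⇒m<n∨m≡n B≤1+n
... | inj₁ B<1+n rewrite ¬T-false {n <ᵇ B} (λ t → <⇒≱ (<ᵇ⇒< n B t) (s≤s⁻¹ B<1+n)) =
  trans (LP.++-identityʳ _) (bfilter-<ᵇ-range0 B n (s≤s⁻¹ B<1+n))
... | inj₂ refl rewrite T-true (<⇒<ᵇ (n<1+n n)) =
  cong (_++ n ∷ []) (bfilter-all _ (range0 n) (λ b b∈ → <⇒<ᵇ (m≤n⇒m≤1+n (∈-range0⁻ n b∈))))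

blocks≡range0 : ∀ π → T (isRGS π) → blocks π ≡ range0 (nblocks π)
blocks≡range0 π h = trans (bfilter-cong _ (_<ᵇ nblocks π) (range0 (length π)) occurs⇔<)
                          (bfilter-<ᵇ-range0 (nblocks π) (length π) (nblocks≤length π h))
  where
  occurs⇔< : ∀ b → b ∈ range0 (length π) → anyB (λ i → labelAt π i ≡ᵇ b) (ground π) ≡ (b <ᵇ nblocks π)
  occurs⇔< b _ = T-ext
    (λ t → let (i , i∈ , eq) = anyB⁻ _ (ground π) t ; (1≤i , i≤n) = ground-∈⁻ π i∈ in
           <⇒<ᵇ (Occurs⇒<nblocks π (i , 1≤i , i≤n , ≡ᵇ⇒≡ _ _ eq)))
    (λ t → let (i , 1≤i , i≤n , eq) = <nblocks⇒Occurs π h (<ᵇ⇒< b (nblocks π) t) in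
           anyB⁺ _ (ground π) (ground-∈⁺ π 1≤i i≤n) (≡⇒≡ᵇ _ _ eq))

blockMax-IsBlockMax : ∀ π {y} → Occurs π y → IsBlockMax π y (blockMax π y)
blockMax-IsBlockMax π {y} (i , 1≤i , i≤n , eq) with maxL-∈ (blockElems π y)
... | inj₁ max≡0 = ⊥-elim (<⇒≱ 1≤i (≤-trans (maxL-ub _ i∈) (≤-reflexive max≡0)))
  where i∈ = ∈-bfilter⁺ (λ i → labelAt π i ≡ᵇ y) (ground π) (ground-∈⁺ π 1≤i i≤n) (≡⇒≡ᵇ _ _ eq)
... | inj₂ max∈ = mkMax (proj₁ bounds) (proj₂ bounds) (≡ᵇ⇒≡ _ _ (proj₂ (∈-bfilter⁻ _ (ground π) max∈)))
  (λ k max<k k≤n eq → <⇒≱ max<k (maxL-ub _ (∈-bfilter⁺ (λ i → labelAt π i ≡ᵇ y) (ground π)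
    (ground-∈⁺ π (≤-trans (proj₁ bounds) (<⇒≤ max<k)) k≤n) (≡⇒≡ᵇ _ _ eq))))
  where bounds = ground-∈⁻ π (proj₁ (∈-bfilter⁻ _ (ground π) max∈))

IsBlockMax⇒Occurs : ∀ {π y M} → IsBlockMax π y M → Occurs π y
IsBlockMax⇒Occurs mx = _ , 1≤max mx , max≤n mx , max-label mx

module Extension (π : Partition) (x : ℕ) where
  n = length π
  π' = π ++ x ∷ []

  private
    old : ∀ i → 1 ≤ i → i ≤ n → labelAt π' i ≡ labelAt π i
    old i = labelAt-++ π x i

    new : labelAt π' (suc n) ≡ x
    new = labelAt-last π x

    length' : length π' ≡ suc n
    length' = length-∷ʳ π x

  arc-old : ∀ {i j} → IsArc π i j → IsArc π' i j
  arc-old {i} {j} (mkArc 1≤i j≤n i<j same between) = mkArc 1≤i (subst (j ≤_) (sym length') (m≤n⇒m≤1+n j≤n)) i<j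
    (trans (old i 1≤i i≤n) (trans same (sym (old j (≤-trans 1≤i (<⇒≤ i<j)) j≤n))))
    (λ k i<k k<j eq → between k i<k k<j (trans (sym (old i 1≤i i≤n)) (trans eq (old k (≤-trans 1≤i (<⇒≤ i<k)) (≤-trans (<⇒≤ k<j) j≤n)))))
    where i≤n = ≤-trans (<⇒≤ i<j) j≤n

  arc-new : ∀ {i} → IsBlockMax π x i → IsArc π' i (suc n)
  arc-new {i} (mkMax 1≤i i≤n label-i above) = mkArc 1≤i (≤-reflexive (sym length')) (s≤s i≤n)
    (trans (old i 1≤i i≤n) (trans label-i (sym new)))
    (λ k i<k k≤n eq → above k i<k (s≤s⁻¹ k≤n) (trans (sym (old k (≤-trans 1≤i (<⇒≤ i<k)) (s≤s⁻¹ k≤n))) (trans (sym eq) (trans (old i 1≤i i≤n) label-i))))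

  arc-split : ∀ {i j} → IsArc π' i j → IsArc π i j ⊎ (j ≡ suc n × IsBlockMax π x i)
  arc-split {i} {j} (mkArc 1≤i j≤1+n i<j same between) with m≤n⇒m<n∨m≡n (subst (j ≤_) length' j≤1+n)
  ... | inj₁ j<1+n = inj₁ (mkArc 1≤i j≤n i<j
        (trans (sym (old i 1≤i i≤n)) (trans same (old j (≤-trans 1≤i (<⇒≤ i<j)) j≤n)))
        (λ k i<k k<j eq → between k i<k k<j (trans (old i 1≤i i≤n) (trans eq (sym (old k (≤-trans 1≤i (<⇒≤ i<k)) (≤-trans (<⇒≤ k<j) j≤n)))))))
    where
    j≤n = s≤s⁻¹ j<1+n
    i≤n = ≤-trans (<⇒≤ i<j) j≤n
  ... | inj₂ refl = inj₂ (refl , mkMax 1≤i i≤n label-i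
        (λ k i<k k≤n eq → between k i<k (s≤s k≤n) (trans (old i 1≤i i≤n) (trans label-i (trans (sym eq) (sym (old k (≤-trans 1≤i (<⇒≤ i<k)) k≤n)))))))
    where
    i≤n = s≤s⁻¹ i<j
    label-i = trans (sym (old i 1≤i i≤n)) (trans same new)

  nesting-old : ∀ {k N} → IsNesting π k N → IsNesting π' k N
  nesting-old (mkNesting len all c) = mkNesting len (All.map arc-old all) c

  nesting-new : ∀ {k N M} → IsBlockMax π x M → IsNesting π k N → StartsAfter M N → IsNesting π' (suc k) ((M , suc n) ∷ N)
  nesting-new {k} {N} {M} mx (mkNesting len all c) after = mkNesting (cong suc len) (arc-new mx ∷ All.map arc-old all)
    (chain-∷ _ N (encloses N all after) c)
    where
    encloses : ∀ L → AllArcs π L → StartsAfter M L → Encloses (M , suc n) L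
    encloses [] _ _ = tt
    encloses (b ∷ L) (arc ∷ _) M<b = M<b , s≤s (end≤n arc)

  private
    inner-arcs : ∀ a N → IsArc π' (proj₁ a) (proj₂ a) → AllArcs π' N → T (chain (a ∷ N)) → AllArcs π N
    inner-arcs a N arc-a all c = go (chain-ends-below a N c) all
      where
      a≤1+n : proj₂ a ≤ suc n
      a≤1+n = subst (proj₂ a ≤_) length' (end≤n arc-a)
      go : ∀ {L} → All (λ b → proj₂ b < proj₂ a) L → AllArcs π' L → AllArcs π L
      go [] [] = []
      go (b<a ∷ bs) (arc ∷ arcs) with arc-split arc
      ... | inj₁ arc′ = arc′ ∷ go bs arcs
      ... | inj₂ (b≡1+n , _) = ⊥-elim (<⇒≱ b<a (subst (_ ≤_) (sym b≡1+n) a≤1+n))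

  nesting-split : ∀ {k N} → IsNesting π' k N →
    IsNesting π k N ⊎ ∃[ M ] ∃[ N' ] N ≡ (M , suc n) ∷ N' × IsBlockMax π x M × IsNesting π (ℕ.pred k) N' × StartsAfter M N'
  nesting-split {k} {[]} (mkNesting len [] c) = inj₁ (mkNesting len [] c)
  nesting-split {k} {a ∷ N'} (mkNesting len (arc-a ∷ all) c) with arc-split arc-a
  ... | inj₁ arc-a′ = inj₁ (mkNesting len (arc-a′ ∷ inner-arcs a N' arc-a all c) c)
  ... | inj₂ (a≡1+n , mx) = inj₂ (proj₁ a , N' , cong (λ j → (proj₁ a , j) ∷ N') a≡1+n , mx ,
        mkNesting (cong ℕ.pred len) (inner-arcs a N' arc-a all c) (chain-tail a N' c) , starts N' (chain-head a N' c))
    where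
    starts : ∀ L → Encloses a L → StartsAfter (proj₁ a) L
    starts [] _ = tt
    starts (b ∷ L) (a<b , _) = a<b

  maxStart-old : ∀ k → maxStart k π ≤ maxStart k π'
  maxStart-old k = maxStart-lub π k (λ N h → maxStart-ub π' k (nesting-old h))

  maxStart-new : ∀ {M} k → IsBlockMax π x M → FitsAfter π M k → M ≤ maxStart (suc k) π'
  maxStart-new k mx fits with FitsAfter⇒nesting π fits
  ... | N , h , after = maxStart-ub π' (suc k) (nesting-new mx h after)

  maxStart-≤ : ∀ {M} k {y} → IsBlockMax π x M → maxStart (suc k) π ≤ y → (FitsAfter π M k → M ≤ y) → maxStart (suc k) π' ≤ y
  maxStart-≤ {M} k {y} mx old≤y new≤y = maxStart-lub π' (suc k) bound
    where
    bound : ∀ N → IsNesting π' (suc k) N → smallestVertex N ≤ y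
    bound N h with nesting-split h
    ... | inj₁ h′ = ≤-trans (maxStart-ub π (suc k) h′) old≤y
    ... | inj₂ (M₀ , N' , refl , mx₀ , h′ , after) with IsBlockMax-unique π mx₀ mx
    ... | refl = new≤y (nesting⇒FitsAfter π h′ after)

  maxStart-fits : ∀ {M} k → IsBlockMax π x M → FitsAfter π M k → maxStart (suc k) π' ≡ maxStart (suc k) π ⊔ M
  maxStart-fits k mx fits = ≤-antisym (maxStart-≤ k mx (m≤m⊔n _ _) (λ _ → m≤n⊔m _ _))
                                      (⊔-lub (maxStart-old (suc k)) (maxStart-new k mx fits))

  maxStart-¬fits : ∀ {M} k → IsBlockMax π x M → ¬ FitsAfter π M k → maxStart (suc k) π' ≡ maxStart (suc k) π
  maxStart-¬fits k mx ¬fits = ≤-antisym (maxStart-≤ k mx ≤-refl (⊥-elim ∘ ¬fits)) (maxStart-old (suc k))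

  maxStart-fresh : ∀ k → (∀ i → ¬ IsBlockMax π x i) → maxStart k π' ≡ maxStart k π
  maxStart-fresh k fresh = ≤-antisym (maxStart-lub π' k bound) (maxStart-old k)
    where
    bound : ∀ N → IsNesting π' k N → smallestVertex N ≤ maxStart k π
    bound N h with nesting-split h
    ... | inj₁ h′ = maxStart-ub π k h′
    ... | inj₂ (M₀ , _ , _ , mx₀ , _) = ⊥-elim (fresh M₀ mx₀)

  hasNesting-old : ∀ k → T (hasNesting k π) → T (hasNesting k π')
  hasNesting-old k h = hasNesting⁺ π' k (nesting-old (proj₂ (hasNesting⁻ π k h)))

  hasNesting-fresh : ∀ k → (∀ i → ¬ IsBlockMax π x i) → T (hasNesting k π') → T (hasNesting k π)
  hasNesting-fresh k fresh h with nesting-split (proj₂ (hasNesting⁻ π' k h))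
  ... | inj₁ h′ = hasNesting⁺ π k h′
  ... | inj₂ (M₀ , _ , _ , mx₀ , _) = ⊥-elim (fresh M₀ mx₀)

  hasNesting-new⁺ : ∀ {M} k → IsBlockMax π x M → FitsAfter π M k → T (hasNesting (suc k) π')
  hasNesting-new⁺ k mx fits with FitsAfter⇒nesting π fits
  ... | N , h , after = hasNesting⁺ π' (suc k) (nesting-new mx h after)

  hasNesting-new⁻ : ∀ {M} k → IsBlockMax π x M → T (hasNesting (suc k) π') → T (hasNesting (suc k) π) ⊎ FitsAfter π M k
  hasNesting-new⁻ k mx h with hasNesting⁻ π' (suc k) h
  ... | N , hN with nesting-split hN
  ... | inj₁ h′ = inj₁ (hasNesting⁺ π (suc k) h′)
  ... | inj₂ (M₀ , N' , refl , mx₀ , h′ , after) with IsBlockMax-unique π mx₀ mx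
  ... | refl = inj₂ (nesting⇒FitsAfter π h′ after)

  occurs-old : ∀ {y} → Occurs π y → Occurs π' y
  occurs-old (i , 1≤i , i≤n , eq) = i , 1≤i , subst (i ≤_) (sym length') (m≤n⇒m≤1+n i≤n) , trans (old i 1≤i i≤n) eq

  blockMax-other : ∀ {y} → Occurs π y → y ≢ x → blockMax π' y ≡ blockMax π y
  blockMax-other {y} occ y≢x = IsBlockMax-unique π' (blockMax-IsBlockMax π' (occurs-old occ)) still-max
    where
    mx = blockMax-IsBlockMax π occ
    still-max : IsBlockMax π' y (blockMax π y)
    still-max = mkMax (1≤max mx) (subst (_ ≤_) (sym length') (m≤n⇒m≤1+n (max≤n mx)))
      (trans (old _ (1≤max mx) (max≤n mx)) (max-label mx)) beyond
      where
      beyond : ∀ k → blockMax π y < k → k ≤ length π' → labelAt π' k ≢ y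
      beyond k M<k k≤1+n eq with m≤n⇒m<n∨m≡n (subst (k ≤_) length' k≤1+n)
      ... | inj₁ k<1+n = above-max mx k M<k (s≤s⁻¹ k<1+n) (trans (sym (old k (≤-trans (1≤max mx) (<⇒≤ M<k)) (s≤s⁻¹ k<1+n))) eq)
      ... | inj₂ refl = y≢x (trans (sym eq) new)

  blockMax-self : blockMax π' x ≡ suc n
  blockMax-self = IsBlockMax-unique π' (blockMax-IsBlockMax π' (IsBlockMax⇒Occurs self)) self
    where
    self : IsBlockMax π' x (suc n)
    self = mkMax (s≤s z≤n) (≤-reflexive (sym length')) new (λ k n<k k≤ _ → <⇒≱ n<k (subst (k ≤_) length' k≤))

-- The statistics a_k under adding n+1 to a block

blocksAbove : Partition → ℕ → ℕ
blocksAbove π t = length (bfilter (λ b → t <ᵇ blockMax π b) (range0 (nblocks π)))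

aStat≡blocksAbove : ∀ π k → T (isRGS π) → aStat k π ≡ suc (blocksAbove π (maxStart k π))
aStat≡blocksAbove π k rg with hasNesting k π in eq
... | true = cong (λ bs → suc (length (bfilter (λ b → maxStart k π <ᵇ blockMax π b) bs))) (blocks≡range0 π rg)
... | false = cong suc (trans (cong length (blocks≡range0 π rg)) (cong length (sym (bfilter-all _ (range0 (nblocks π)) all-above))))
  where
  -- without k-nestings maxStart is 0, and every block maximum is positive
  all-above : ∀ b → b ∈ range0 (nblocks π) → T (maxStart k π <ᵇ blockMax π b)
  all-above b b∈ rewrite ¬hasNesting⇒nestings≡[] π k (subst T eq) =
    <⇒<ᵇ (1≤max (blockMax-IsBlockMax π (<nblocks⇒Occurs π rg (∈-range0⁻ (nblocks π) b∈))))

blocksAbove-anti : ∀ π {t t'} → t ≤ t' → blocksAbove π t' ≤ blocksAbove π t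
blocksAbove-anti π {t} {t'} t≤t' = go (range0 (nblocks π))
  where
  go : ∀ xs → length (bfilter (λ b → t' <ᵇ blockMax π b) xs) ≤ length (bfilter (λ b → t <ᵇ blockMax π b) xs)
  go [] = z≤n
  go (b ∷ xs) with t' <ᵇ blockMax π b in e' | t <ᵇ blockMax π b in e
  ... | true | true = s≤s (go xs)
  ... | true | false = ⊥-elim (subst T e (<⇒<ᵇ (≤-<-trans t≤t' (<ᵇ⇒< t' (blockMax π b) (subst T (sym e') tt)))))
  ... | false | true = m≤n⇒m≤1+n (go xs)
  ... | false | false = go xs

module Append (π : Partition) (x : ℕ) (rg : T (isRGS π)) (x≤nb : x ≤ nblocks π) where
  open Extension π x
  nb = nblocks π

  rg' : T (isRGS π')
  rg' = subst T (sym (rgsFrom-∷ʳ 0 π x)) (T-∧-intro rg (≤⇒≤ᵇ x≤nb))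

  inΠ-init : ∀ m → T (inΠ m π') → T (inΠ m π)
  inΠ-init m h = T-not⁺ (T-not⁻ h ∘ hasNesting-old (suc m))

  module NewBlock (x≡nb : x ≡ nb) where
    fresh : ∀ i → ¬ IsBlockMax π x i
    fresh i mx = <-irrefl x≡nb (Occurs⇒<nblocks π (IsBlockMax⇒Occurs mx))

    blocksAbove-new : ∀ t → t ≤ n → blocksAbove π' t ≡ suc (blocksAbove π t)
    blocksAbove-new t t≤n = begin
      blocksAbove π' t
        ≡⟨ cong (λ k → length (bfilter (λ b → t <ᵇ blockMax π' b) (range0 k))) nblocks' ⟩
      length (bfilter (λ b → t <ᵇ blockMax π' b) (range0 nb ++ nb ∷ []))
        ≡⟨ length-bfilter-++ _ (range0 nb) (nb ∷ []) ⟩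
      length (bfilter (λ b → t <ᵇ blockMax π' b) (range0 nb)) + length (bfilter (λ b → t <ᵇ blockMax π' b) (nb ∷ []))
        ≡⟨ cong₂ _+_ (cong length (bfilter-cong _ _ (range0 nb) old-blocks)) new-block ⟩
      blocksAbove π t + 1
        ≡⟨ +-comm _ 1 ⟩
      suc (blocksAbove π t) ∎
      where
      open ≡-Reasoning
      nblocks' : nblocks π' ≡ suc nb
      nblocks' = trans (labelBound-∷ʳ 0 π x) (trans (cong (λ y → nb ⊔ suc y) x≡nb) (m≤n⇒m⊔n≡n (n≤1+n nb)))
      old-blocks : ∀ b → b ∈ range0 nb → (t <ᵇ blockMax π' b) ≡ (t <ᵇ blockMax π b)
      old-blocks b b∈ = cong (t <ᵇ_) (blockMax-other (<nblocks⇒Occurs π rg (∈-range0⁻ nb b∈)) (λ b≡x → <-irrefl (trans b≡x x≡nb) (∈-range0⁻ nb b∈)))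
      new-block : length (bfilter (λ b → t <ᵇ blockMax π' b) (nb ∷ [])) ≡ 1
      new-block rewrite sym x≡nb | blockMax-self | T-true (<⇒<ᵇ (s≤s t≤n)) = refl

    aStat-new : ∀ k → aStat k π' ≡ suc (aStat k π)
    aStat-new k = begin
      aStat k π'                              ≡⟨ aStat≡blocksAbove π' k rg' ⟩
      suc (blocksAbove π' (maxStart k π'))    ≡⟨ cong (suc ∘ blocksAbove π') (maxStart-fresh k fresh) ⟩
      suc (blocksAbove π' (maxStart k π))     ≡⟨ cong suc (blocksAbove-new _ (maxStart≤length π k)) ⟩
      suc (suc (blocksAbove π (maxStart k π))) ≡⟨ cong suc (aStat≡blocksAbove π k rg) ⟨
      suc (aStat k π)                         ∎
      where open ≡-Reasoning

    inΠ-new : ∀ m → T (inΠ m π) → T (inΠ m π')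
    inΠ-new m h = T-not⁺ (T-not⁻ h ∘ hasNesting-fresh (suc m) fresh)

  module OldBlock (x<nb : x < nb) where
    M = blockMax π x

    mx : IsBlockMax π x M
    mx = blockMax-IsBlockMax π (<nblocks⇒Occurs π rg x<nb)

    nblocks' : nblocks π' ≡ nb
    nblocks' = trans (labelBound-∷ʳ 0 π x) (m≥n⇒m⊔n≡m x<nb)

    blocksAbove-<M : ∀ t → t < M → blocksAbove π' t ≡ blocksAbove π t
    blocksAbove-<M t t<M = trans (cong (λ k → length (bfilter (λ b → t <ᵇ blockMax π' b) (range0 k))) nblocks')
                                 (cong length (bfilter-cong _ _ (range0 nb) same))
      where
      same : ∀ b → b ∈ range0 nb → (t <ᵇ blockMax π' b) ≡ (t <ᵇ blockMax π b)
      same b b∈ with b ≟ x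
      ... | yes refl rewrite blockMax-self = trans (T-true (<⇒<ᵇ (≤-trans t<M (m≤n⇒m≤1+n (max≤n mx))))) (sym (T-true (<⇒<ᵇ t<M)))
      ... | no b≢x = cong (t <ᵇ_) (blockMax-other (<nblocks⇒Occurs π rg (∈-range0⁻ nb b∈)) b≢x)

    blocksAbove-≥M : ∀ t → M ≤ t → t ≤ n → blocksAbove π' t ≡ suc (blocksAbove π t)
    blocksAbove-≥M t M≤t t≤n = begin
      blocksAbove π' t
        ≡⟨ cong (λ k → length (bfilter (λ b → t <ᵇ blockMax π' b) (range0 k))) nblocks' ⟩
      length (bfilter (λ b → t <ᵇ blockMax π' b) (range0 nb))
        ≡⟨ length-bfilter-∨ _ (λ b → t <ᵇ blockMax π b) (_≡ᵇ x) (range0 nb) split disjoint ⟩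
      blocksAbove π t + length (bfilter (_≡ᵇ x) (range0 nb))
        ≡⟨ cong (λ k → blocksAbove π t + k) (length-bfilter-≡ᵇ x nb x<nb) ⟩
      blocksAbove π t + 1
        ≡⟨ +-comm _ 1 ⟩
      suc (blocksAbove π t) ∎
      where
      open ≡-Reasoning
      split : ∀ b → b ∈ range0 nb → (t <ᵇ blockMax π' b) ≡ (t <ᵇ blockMax π b) ∨ (b ≡ᵇ x)
      split b b∈ with b ≟ x
      ... | yes refl rewrite blockMax-self | T-true (≡⇒≡ᵇ x x refl) | T-true (<⇒<ᵇ (s≤s t≤n)) = sym (∨-zeroʳ _)
      ... | no b≢x rewrite ¬T-false {b ≡ᵇ x} (b≢x ∘ ≡ᵇ⇒≡ b x) =
        trans (cong (t <ᵇ_) (blockMax-other (<nblocks⇒Occurs π rg (∈-range0⁻ nb b∈)) b≢x)) (sym (∨-identityʳ _))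
      disjoint : ∀ b → b ∈ range0 nb → ¬ (T (t <ᵇ blockMax π b) × T (b ≡ᵇ x))
      disjoint b _ (t<Mb , b≡x) rewrite ≡ᵇ⇒≡ b x b≡x = <⇒≱ (<ᵇ⇒< t M t<Mb) M≤t

    aStat-grows : ∀ k → M ≤ maxStart (suc k) π → FitsAfter π M k → aStat (suc k) π' ≡ suc (aStat (suc k) π)
    aStat-grows k M≤max fits = begin
      aStat (suc k) π'                                  ≡⟨ aStat≡blocksAbove π' (suc k) rg' ⟩
      suc (blocksAbove π' (maxStart (suc k) π'))        ≡⟨ cong (suc ∘ blocksAbove π') (maxStart-fits k mx fits) ⟩
      suc (blocksAbove π' (maxStart (suc k) π ⊔ M))     ≡⟨ cong (suc ∘ blocksAbove π') (m≥n⇒m⊔n≡m M≤max) ⟩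
      suc (blocksAbove π' (maxStart (suc k) π))         ≡⟨ cong suc (blocksAbove-≥M _ M≤max (maxStart≤length π (suc k))) ⟩
      suc (suc (blocksAbove π (maxStart (suc k) π)))    ≡⟨ cong suc (aStat≡blocksAbove π (suc k) rg) ⟨
      suc (aStat (suc k) π)                             ∎
      where open ≡-Reasoning

    aStat-jumps : ∀ k → maxStart (suc k) π < M → FitsAfter π M k → aStat (suc k) π' ≡ suc (suc (blocksAbove π M))
    aStat-jumps k max<M fits = begin
      aStat (suc k) π'                                  ≡⟨ aStat≡blocksAbove π' (suc k) rg' ⟩
      suc (blocksAbove π' (maxStart (suc k) π'))        ≡⟨ cong (suc ∘ blocksAbove π') (maxStart-fits k mx fits) ⟩
      suc (blocksAbove π' (maxStart (suc k) π ⊔ M))     ≡⟨ cong (suc ∘ blocksAbove π') (m≤n⇒m⊔n≡n (<⇒≤ max<M)) ⟩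
      suc (blocksAbove π' M)                            ≡⟨ cong suc (blocksAbove-≥M M ≤-refl (max≤n mx)) ⟩
      suc (suc (blocksAbove π M))                       ∎
      where open ≡-Reasoning

    aStat-stays : ∀ k → maxStart (suc k) π < M → ¬ FitsAfter π M k → aStat (suc k) π' ≡ aStat (suc k) π
    aStat-stays k max<M ¬fits = begin
      aStat (suc k) π'                                  ≡⟨ aStat≡blocksAbove π' (suc k) rg' ⟩
      suc (blocksAbove π' (maxStart (suc k) π'))        ≡⟨ cong (suc ∘ blocksAbove π') (maxStart-¬fits k mx ¬fits) ⟩
      suc (blocksAbove π' (maxStart (suc k) π))         ≡⟨ cong suc (blocksAbove-<M _ max<M) ⟩
      suc (blocksAbove π (maxStart (suc k) π))          ≡⟨ aStat≡blocksAbove π (suc k) rg ⟨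
      aStat (suc k) π                                   ∎
      where open ≡-Reasoning

    inΠ-old : ∀ m → 1 ≤ m → T (inΠ m π) → inΠ m π' ≡ (maxStart m π <ᵇ M)
    inΠ-old m 1≤m h = T-ext to from
      where
      to : T (inΠ m π') → T (maxStart m π <ᵇ M)
      to t with <-cmp M (maxStart m π)
      ... | tri< M<max _ _ = ⊥-elim (T-not⁻ t (hasNesting-new⁺ m mx (inj₂ M<max)))
      ... | tri≈ _ M≡max _ = ⊥-elim (maxStart≢blockMax π m mx (sym M≡max))
      ... | tri> _ _ max<M = <⇒<ᵇ max<M
      from : T (maxStart m π <ᵇ M) → T (inΠ m π')
      from t = T-not⁺ λ nested → case hasNesting-new⁻ m mx nested of λ where
        (inj₁ old) → T-not⁻ h old
        (inj₂ (inj₁ m≡0)) → <⇒≢ 1≤m (sym m≡0)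
        (inj₂ (inj₂ M<max)) → <-asym M<max (<ᵇ⇒< _ M t)

-- Partitions of [n+1] as one-letter extensions of partitions of [n]

unique-bfilter : (p : A → Bool) {xs : List A} → Unique xs → Unique (bfilter p xs)
unique-bfilter p {xs} u = subst Unique (sym (bfilter≡filterᵇ p xs)) (Unique.filter⁺ (T? ∘ p) u)

unique-concatMap : (f : A → List B) (xs : List A) → Unique xs → (∀ a → a ∈ xs → Unique (f a)) →
  (∀ a b z → z ∈ f a → z ∈ f b → a ≡ b) → Unique (concatMap f xs)
unique-concatMap f [] _ _ _ = []
unique-concatMap f (a ∷ xs) (a∉ ∷ u) uf disj = Unique.++⁺ (uf a (here refl)) (unique-concatMap f xs u (λ b b∈ → uf b (there b∈)) disj)
  λ (z∈fa , z∈rest) → let (b , b∈ , z∈fb) = find (∈-concatMap⁻ f {xs = xs} z∈rest) in All.lookup a∉ b∈ (disj a b _ z∈fa z∈fb)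

unique-range0 : ∀ k → Unique (range0 k)
unique-range0 zero = []
unique-range0 (suc k) = Unique.++⁺ (unique-range0 k) ([] ∷ []) λ { (k∈ , here refl) → <-irrefl refl (∈-range0⁻ k k∈) }

unique-allLists : ∀ n k → Unique (allLists n k)
unique-allLists zero k = [] ∷ []
unique-allLists (suc n) k = unique-concatMap _ (range0 k) (unique-range0 k)
  (λ a _ → Unique.map⁺ (proj₂ ∘ LP.∷-injective) (unique-allLists n k))
  (λ a b z z∈a z∈b → let (_ , _ , eqa) = ∈-map⁻ (a ∷_) z∈a ; (_ , _ , eqb) = ∈-map⁻ (b ∷_) z∈b in
    proj₁ (LP.∷-injective (trans (sym eqa) eqb)))

∈-allLists⁻ : ∀ n k {σ} → σ ∈ allLists n k → length σ ≡ n × All (_< k) σ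
∈-allLists⁻ zero k (here refl) = refl , []
∈-allLists⁻ (suc n) k h with find (∈-concatMap⁻ _ {xs = range0 k} h)
... | a , a∈ , σ∈ with ∈-map⁻ (a ∷_) σ∈
... | σ , σ∈′ , refl = let (len , all) = ∈-allLists⁻ n k σ∈′ in cong suc len , (∈-range0⁻ k a∈ ∷ all)

∈-allLists⁺ : ∀ k σ → All (_< k) σ → σ ∈ allLists (length σ) k
∈-allLists⁺ k [] [] = here refl
∈-allLists⁺ k (a ∷ σ) (a<k ∷ all) = ∈-concatMap⁺ _ {xs = range0 k} (lose (∈-range0⁺ k a<k) (∈-map⁺ (a ∷_) (∈-allLists⁺ k σ all)))

rgsFrom-bounded : ∀ b xs → T (rgsFrom b xs) → All (_< b + length xs) xs
rgsFrom-bounded b [] _ = []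
rgsFrom-bounded b (z ∷ xs) h =
  subst (suc z ≤_) (sym (+-suc b (length xs))) (s≤s (≤-trans (≤ᵇ⇒≤ z b (T-∧-fst h)) (m≤m+n b (length xs))))
  ∷ All.map (λ lt → ≤-trans lt (≤-trans (+-monoˡ-≤ (length xs) (⊔-lub (n≤1+n b) (s≤s (≤ᵇ⇒≤ z b (T-∧-fst h)))))
                                                 (≤-reflexive (sym (+-suc b (length xs))))))
            (rgsFrom-bounded (b ⊔ suc z) xs (T-∧-snd {z ≤ᵇ b} h))

∈-partitionsOf⁻ : ∀ n {π} → π ∈ partitionsOf n → T (isRGS π) × length π ≡ n
∈-partitionsOf⁻ n h = let (π∈ , rg) = ∈-bfilter⁻ isRGS _ h in rg , proj₁ (∈-allLists⁻ n n π∈)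

∈-partitionsOf⁺ : ∀ {π} → T (isRGS π) → π ∈ partitionsOf (length π)
∈-partitionsOf⁺ {π} rg = ∈-bfilter⁺ isRGS _ (∈-allLists⁺ (length π) π
  (subst (λ k → All (_< k) π) refl (rgsFrom-bounded 0 π rg))) rg

extensions : ℕ → List Partition
extensions n = concatMap (λ π → map (λ x → π ++ x ∷ []) (range0 (suc (nblocks π)))) (partitionsOf n)

partitionsOf-suc↭extensions : ∀ n → partitionsOf (suc n) ↭ extensions n
partitionsOf-suc↭extensions n = ∼bag⇒↭ (unique∧set⇒bag
  (unique-bfilter isRGS (unique-allLists (suc n) (suc n)))
  (unique-concatMap _ (partitionsOf n) (unique-bfilter isRGS (unique-allLists n n))
    (λ π _ → Unique.map⁺ (λ eq → proj₂ (LP.∷ʳ-injective π π eq)) (unique-range0 _))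
    (λ a b z z∈a z∈b → let (_ , _ , eqa) = ∈-map⁻ _ z∈a ; (_ , _ , eqb) = ∈-map⁻ _ z∈b in
      proj₁ (LP.∷ʳ-injective a b (trans (sym eqa) eqb))))
  (mk⇔ to from))
  where
  to : ∀ {σ} → σ ∈ partitionsOf (suc n) → σ ∈ extensions n
  to {σ} σ∈ with ∈-partitionsOf⁻ (suc n) σ∈ | initLast σ
  ... | _ , () | []
  ... | rg , len | π ∷ʳ′ x = ∈-concatMap⁺ _ {xs = partitionsOf n}
      (lose (subst (λ k → π ∈ partitionsOf k) |π|≡n (∈-partitionsOf⁺ (T-∧-fst rg′)))
            (∈-map⁺ (λ x → π ++ x ∷ []) (∈-range0⁺ (suc (nblocks π)) (s≤s (≤ᵇ⇒≤ x _ (T-∧-snd {isRGS π} rg′))))))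
    where
    rg′ : T (isRGS π ∧ (x ≤ᵇ nblocks π))
    rg′ = subst T (rgsFrom-∷ʳ 0 π x) rg
    |π|≡n : length π ≡ n
    |π|≡n = suc-injective (trans (sym (length-∷ʳ π x)) len)
  from : ∀ {σ} → σ ∈ extensions n → σ ∈ partitionsOf (suc n)
  from σ∈ with find (∈-concatMap⁻ _ {xs = partitionsOf n} σ∈)
  ... | π , π∈ , σ∈′ with ∈-map⁻ (λ x → π ++ x ∷ []) σ∈′ | ∈-partitionsOf⁻ n π∈
  ... | x , x∈ , refl | rg , len =
    subst (λ k → π ++ x ∷ [] ∈ partitionsOf k) (trans (length-∷ʳ π x) (cong suc len)) (∈-partitionsOf⁺ rg′)
    where
    rg′ : T (isRGS (π ++ x ∷ []))
    rg′ = subst T (sym (rgsFrom-∷ʳ 0 π x)) (T-∧-intro rg (≤⇒≤ᵇ (s≤s⁻¹ (∈-range0⁻ (suc (nblocks π)) x∈))))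

-- The functional equation

module FunctionalEquation (m : ℕ) (1≤m : 1 ≤ m) where

  term : Partition → ℤ × Exp m
  term π = + 1 , aVec m π

  admissible : ℕ → List Partition
  admissible n = bfilter (inΠ m) (partitionsOf n)

  ∈-admissible⁻ : ∀ {n π} → π ∈ admissible n → T (isRGS π) × T (inΠ m π)
  ∈-admissible⁻ {n} π∈ = let (π∈′ , inΠ) = ∈-bfilter⁻ (inΠ m) _ π∈ in proj₁ (∈-partitionsOf⁻ n π∈′) , inΠ

  _·_ : ℤ × Exp m → ℤ × Exp m → ℤ × Exp m
  (c , e) · (d , f) = c ℤ.* d , addE e f

  -- Dividing u^e - u^(e with e_j := lo) by u_j - 1 leaves the u^(e with e_j := i) for lo ≤ i < e_j,
  -- where lo = 1 for j = 1 and lo = e_{j-1} otherwise.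
  lower : ℕ → Exp m → ℕ
  lower zero e = 0
  lower (suc zero) e = 1
  lower (suc (suc j)) e = getE e (suc j)

  quotientTerms : ℕ → Exp m → Poly m
  quotientTerms j e = map (λ i → (+ 1 , setE e j i)) (upFrom (lower j e) (getE e j ∸ lower j e))

  Q : ℕ → FPS m
  Q j n = concatMap (quotientTerms j ∘ aVec m) (admissible n)

  quotientPart : ℕ → Exp m → Poly m
  quotientPart j e = map ((+ 1 , onesUpTo m j) ·_) (quotientTerms j e)

  quotientsUpTo : ℕ → Exp m → Poly m
  quotientsUpTo k e = map ((+ 1 , unitE m 1) ·_) (quotientTerms 1 e) ++ concatMap (λ j → quotientPart j e) (rangeFT 2 k)

  extensionTerms : Partition → Poly m
  extensionTerms π = concatMap (λ x → guard (inΠ m (π ++ x ∷ [])) (term (π ++ x ∷ []) ∷ [])) (range0 (suc (nblocks π)))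

  rhsTerms : Partition → Poly m
  rhsTerms π = (+ 1 , addE (onesUpTo m m) (aVec m π)) ∷ [] ++ quotientsUpTo m (aVec m π)

  getE-aVec-blocksAbove : ∀ π → T (isRGS π) → ∀ i → 1 ≤ i → i ≤ m → getE (aVec m π) i ≡ suc (blocksAbove π (maxStart i π))
  getE-aVec-blocksAbove π rg i 1≤i i≤m = trans (getE-aVec m π i 1≤i i≤m) (aStat≡blocksAbove π i rg)

  lower≤ : ∀ π → T (isRGS π) → ∀ j → 1 ≤ j → j ≤ m → lower j (aVec m π) ≤ getE (aVec m π) j
  lower≤ π rg (suc zero) _ 1≤m′ = subst (1 ≤_) (sym (getE-aVec-blocksAbove π rg 1 (s≤s z≤n) 1≤m′)) (s≤s z≤n)
  lower≤ π rg (suc (suc j)) _ j≤m = subst₂ _≤_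
    (sym (getE-aVec-blocksAbove π rg (suc j) (s≤s z≤n) (≤-trans (n≤1+n _) j≤m)))
    (sym (getE-aVec-blocksAbove π rg (suc (suc j)) (s≤s z≤n) j≤m))
    (s≤s (blocksAbove-anti π (maxStart-suc π (suc j) (s≤s z≤n))))

  quotientTerms-telescope : ∀ j → 1 ≤ j → j ≤ m → ∀ π → T (isRGS π) →
    map ((+ 1 , unitE m j) ·_) (quotientTerms j (aVec m π)) ++ map ((-[1+ 0 ] , zeroE m) ·_) (quotientTerms j (aVec m π))
      ≈ term π ∷ (-[1+ 0 ] , setE (aVec m π) j (lower j (aVec m π))) ∷ []
  quotientTerms-telescope j 1≤j j≤m π rg = begin
    map ((+ 1 , unitE m j) ·_) (map (λ i → (+ 1 , E i)) R) ++ map ((-[1+ 0 ] , zeroE m) ·_) (map (λ i → (+ 1 , E i)) R)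
      ≡⟨ cong₂ _++_ (trans (sym (LP.map-∘ R)) (LP.map-cong (λ i → cong (+ 1 ,_) (addE-unitE-setE e j i 1≤j j≤m)) R))
                    (trans (sym (LP.map-∘ R)) (LP.map-cong (λ i → cong (-[1+ 0 ] ,_) (addE-identityˡ (E i))) R)) ⟩
    map (λ i → (+ 1 , E (suc i))) R ++ map (λ i → (-[1+ 0 ] , E i)) R
      ≈⟨ upFrom-telescope E (lower j e) (getE e j ∸ lower j e) ⟩
    (+ 1 , E (lower j e + (getE e j ∸ lower j e))) ∷ (-[1+ 0 ] , E (lower j e)) ∷ []
      ≡⟨ cong (λ f → (+ 1 , f) ∷ (-[1+ 0 ] , E (lower j e)) ∷ [])
              (trans (cong E (m+[n∸m]≡n (lower≤ π rg j 1≤j j≤m))) (setE-getE e j)) ⟩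
    term π ∷ (-[1+ 0 ] , E (lower j e)) ∷ [] ∎
    where
    open SetoidReasoning ≈-setoid
    e = aVec m π
    E : ℕ → Exp m
    E = setE e j
    R = upFrom (lower j e) (getE e j ∸ lower j e)

  quotient-by-terms : ∀ j n → 1 ≤ j → j ≤ m →
    ((var m j ⊕ (⊖ onePoly m)) ·F Q j) n
      ≈ map term (admissible n) ++ concatMap (λ π → (-[1+ 0 ] , setE (aVec m π) j (lower j (aVec m π))) ∷ []) (admissible n)
  quotient-by-terms j n 1≤j j≤m = begin
    map ((+ 1 , unitE m j) ·_) (Q j n) ++ (map ((-[1+ 0 ] , zeroE m) ·_) (Q j n) ++ [])
      ≡⟨ cong₂ _++_ (LP.map-concatMap _ (quotientTerms j ∘ aVec m) (admissible n))
                    (trans (LP.++-identityʳ _) (LP.map-concatMap _ (quotientTerms j ∘ aVec m) (admissible n))) ⟩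
    concatMap (map ((+ 1 , unitE m j) ·_) ∘ quotientTerms j ∘ aVec m) (admissible n)
      ++ concatMap (map ((-[1+ 0 ] , zeroE m) ·_) ∘ quotientTerms j ∘ aVec m) (admissible n)
      ≈⟨ concatMap-++-≈ _ _ (admissible n) ⟨
    concatMap (λ π → map ((+ 1 , unitE m j) ·_) (quotientTerms j (aVec m π)) ++ map ((-[1+ 0 ] , zeroE m) ·_) (quotientTerms j (aVec m π))) (admissible n)
      ≈⟨ concatMap-cong-≈ _ _ (admissible n) (λ π π∈ → quotientTerms-telescope j 1≤j j≤m π (proj₁ (∈-admissible⁻ {n} π∈))) ⟩
    concatMap (λ π → term π ∷ (-[1+ 0 ] , setE (aVec m π) j (lower j (aVec m π))) ∷ []) (admissible n)
      ≈⟨ concatMap-++-≈ (λ π → term π ∷ []) _ (admissible n) ⟩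
    concatMap (λ π → term π ∷ []) (admissible n) ++ concatMap (λ π → (-[1+ 0 ] , setE (aVec m π) j (lower j (aVec m π))) ∷ []) (admissible n)
      ≡⟨ cong (_++ concatMap (λ π → (-[1+ 0 ] , setE (aVec m π) j (lower j (aVec m π))) ∷ []) (admissible n))
              (sym (map-as-concatMap term (admissible n))) ⟩
    map term (admissible n) ++ concatMap (λ π → (-[1+ 0 ] , setE (aVec m π) j (lower j (aVec m π))) ∷ []) (admissible n) ∎
    where open SetoidReasoning ≈-setoid

  quotient : ∀ j → 1 ≤ j → j ≤ m → IsQuotient m j (Q j)
  quotient (suc zero) 1≤j j≤m n = coeffs (≈-trans (quotient-by-terms 1 n 1≤j j≤m) (≡⇒≈ (cong (map term (admissible n) ++_) (begin
    concatMap (λ π → (-[1+ 0 ] , setE (aVec m π) 1 1) ∷ []) (admissible n)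
      ≡⟨ concatMap-cong-∈ _ _ (admissible n) (λ π _ → cong (λ e → (-[1+ 0 ] , e) ∷ []) (sym (addE-unitE-setE (aVec m π) 1 0 (s≤s z≤n) 1≤m))) ⟩
    concatMap (λ π → (-[1+ 0 ] , addE (unitE m 1) (setE (aVec m π) 1 0)) ∷ []) (admissible n)
      ≡⟨ map-as-concatMap _ (admissible n) ⟨
    map (λ π → (-[1+ 0 ] , addE (unitE m 1) (setE (aVec m π) 1 0))) (admissible n)
      ≡⟨ trans (LP.map-∘ (admissible n)) (trans (LP.map-∘ (map term (admissible n))) (cong ⊖_ (trans (LP.map-∘ _) (sym (LP.++-identityʳ _))))) ⟩
    ⊖ (var m 1 ⊗ substE σ₁ (Ftilde m n)) ∎))))
    where open ≡-Reasoning
  quotient (suc (suc j)) 1≤j j≤m n = coeffs (≈-trans (quotient-by-terms (suc (suc j)) n 1≤j j≤m) (≡⇒≈ (cong (map term (admissible n) ++_)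
    (trans (sym (map-as-concatMap _ (admissible n))) (trans (LP.map-∘ (admissible n)) (LP.map-∘ (map term (admissible n))))))))

  -- Appending to block x, whose maximum lies between maxStart j π and maxStart (j - 1) π, raises a_i by
  -- one for i < j, sets a_j to 2 + #(blocks ending after x's), and leaves a_i unchanged for i > j.
  module Children (π : Partition) (rg : T (isRGS π)) where
    e = aVec m π
    nb = nblocks π
    top = blockMax π

    child-aVec : ∀ j x → 1 ≤ j → j ≤ m → (x<nb : x < nb) → maxStart j π < top x → (1 < j → top x ≤ maxStart (j ∸ 1) π) →
      (w : Exp m) → (∀ i → 1 ≤ i → i ≤ m → getE w i ≡ (if i ≤ᵇ j then 1 else 0)) →
      aVec m (π ++ x ∷ []) ≡ addE w (setE e j (suc (blocksAbove π (top x))))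
    child-aVec j x 1≤j j≤m x<nb max<top top≤prev w getE-w = getE-ext _ _ coordinate
      where
      open Append π x rg (<⇒≤ x<nb)
      open OldBlock x<nb
      ones : ∀ i → 1 ≤ i → i ≤ m → i ≤ j → getE w i ≡ 1
      ones i 1≤i i≤m i≤j = trans (getE-w i 1≤i i≤m) (cong (λ b → if b then 1 else 0) (T-true (≤⇒≤ᵇ i≤j)))
      fits-below : ∀ k → k < j → FitsAfter π M k
      fits-below zero _ = inj₁ refl
      fits-below (suc k) k<j = inj₂ (≤∧≢⇒< (≤-trans (top≤prev (≤-<-trans (s≤s z≤n) k<j)) (maxStart-anti π (s≤s z≤n) (∸-monoˡ-≤ 1 k<j)))
                                              (maxStart≢blockMax π (suc k) mx ∘ sym))
      coordinate : ∀ i → 1 ≤ i → i ≤ m → getE (aVec m (π ++ x ∷ [])) i ≡ getE (addE w (setE e j (suc (blocksAbove π (top x))))) i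
      coordinate (suc k) 1≤i i≤m with <-cmp (suc k) j
      ... | tri< i<j _ _ = begin
        getE (aVec m (π ++ x ∷ [])) (suc k)   ≡⟨ getE-aVec m (π ++ x ∷ []) (suc k) 1≤i i≤m ⟩
        aStat (suc k) (π ++ x ∷ [])           ≡⟨ aStat-grows k M≤max (fits-below k (<-trans (n<1+n k) i<j)) ⟩
        suc (aStat (suc k) π)                 ≡⟨ cong₂ _+_ (ones (suc k) 1≤i i≤m (<⇒≤ i<j))
                                                           (trans (getE-setE-≢ e j _ (suc k) (<⇒≢ i<j)) (getE-aVec m π (suc k) 1≤i i≤m)) ⟨
        getE w (suc k) + getE (setE e j _) (suc k)  ≡⟨ getE-addE w _ (suc k) ⟨
        getE (addE w (setE e j _)) (suc k)    ∎
        where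
        open ≡-Reasoning
        M≤max : M ≤ maxStart (suc k) π
        M≤max = ≤-trans (top≤prev (≤-<-trans 1≤i i<j)) (maxStart-anti π 1≤i (∸-monoˡ-≤ 1 i<j))
      ... | tri≈ _ refl _ = begin
        getE (aVec m (π ++ x ∷ [])) j         ≡⟨ getE-aVec m (π ++ x ∷ []) j 1≤i i≤m ⟩
        aStat j (π ++ x ∷ [])                 ≡⟨ aStat-jumps k max<top (fits-below k ≤-refl) ⟩
        suc (suc (blocksAbove π M))           ≡⟨ cong₂ _+_ (ones j 1≤j j≤m ≤-refl) (getE-setE-≡ e j _ 1≤j j≤m) ⟨
        getE w j + getE (setE e j _) j        ≡⟨ getE-addE w _ j ⟨
        getE (addE w (setE e j _)) j          ∎
        where open ≡-Reasoning
      ... | tri> _ _ j<i = begin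
        getE (aVec m (π ++ x ∷ [])) (suc k)   ≡⟨ getE-aVec m (π ++ x ∷ []) (suc k) 1≤i i≤m ⟩
        aStat (suc k) (π ++ x ∷ [])           ≡⟨ aStat-stays k (≤-<-trans (maxStart-anti π 1≤j (<⇒≤ j<i)) max<top) ¬fits ⟩
        aStat (suc k) π                       ≡⟨ cong₂ _+_ zero-w (trans (getE-setE-≢ e j _ (suc k) (<⇒≢ j<i ∘ sym)) (getE-aVec m π (suc k) 1≤i i≤m)) ⟨
        getE w (suc k) + getE (setE e j _) (suc k)  ≡⟨ getE-addE w _ (suc k) ⟨
        getE (addE w (setE e j _)) (suc k)    ∎
        where
        open ≡-Reasoning
        zero-w : getE w (suc k) ≡ 0
        zero-w = trans (getE-w (suc k) 1≤i i≤m) (cong (λ b → if b then 1 else 0) (¬T-false (<⇒≱ j<i ∘ ≤ᵇ⇒≤ (suc k) j)))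
        ¬fits : ¬ FitsAfter π M k
        ¬fits (inj₁ refl) = <⇒≱ j<i 1≤j
        ¬fits (inj₂ M<max) = <⇒≱ M<max (<⇒≤ (≤-<-trans (maxStart-anti π 1≤j (s≤s⁻¹ j<i)) max<top))

    top-injective : ∀ a b → a < nb → b < nb → top a ≡ top b → a ≡ b
    top-injective a b a<nb b<nb eq = trans (sym (max-label (blockMax-IsBlockMax π (<nblocks⇒Occurs π rg a<nb))))
      (trans (cong (labelAt π) eq) (max-label (blockMax-IsBlockMax π (<nblocks⇒Occurs π rg b<nb))))

    top≤length : ∀ a → a < nb → top a ≤ length π
    top≤length a a<nb = max≤n (blockMax-IsBlockMax π (<nblocks⇒Occurs π rg a<nb))

    childTerms : ℕ → Poly m
    childTerms k = concatMap (λ x → guard (maxStart k π <ᵇ top x) (term (π ++ x ∷ []) ∷ [])) (range0 nb)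

    shifted : Exp m → ℕ → ℕ → Poly m
    shifted w j r = (+ 1 , addE w (setE e j r)) ∷ []

    open module Ranks (w : Exp m) (j : ℕ) = RankSum nb (length π) top top-injective top≤length (shifted w j)

    childTerms-1 : childTerms 1 ≈ quotientsUpTo 1 e
    childTerms-1 = begin
      childTerms 1
        ≡⟨ concatMap-cong-∈ _ _ (range0 nb) (λ x x∈ → guard-cong (maxStart 1 π <ᵇ top x) λ max<top →
             cong (λ f → (+ 1 , f) ∷ []) (child-aVec 1 x (s≤s z≤n) 1≤m (∈-range0⁻ nb x∈) (<ᵇ⇒< _ (top x) max<top)
                                                     (λ { (s≤s ()) }) (unitE m 1) (getE-unitE-1 m))) ⟩
      ranks (unitE m 1) 1 (maxStart 1 π)
        ≈⟨ rank-sum (unitE m 1) 1 (maxStart 1 π) ⟩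
      concatMap (shifted (unitE m 1) 1) (upFrom 1 (blocksAbove π (maxStart 1 π)))
        ≡⟨ cong (λ a → concatMap (shifted (unitE m 1) 1) (upFrom 1 (a ∸ 1))) (getE-aVec-blocksAbove π rg 1 (s≤s z≤n) 1≤m) ⟨
      concatMap (shifted (unitE m 1) 1) (upFrom 1 (getE e 1 ∸ 1))
        ≡⟨ trans (sym (LP.map-∘ (upFrom 1 (getE e 1 ∸ 1)))) (map-as-concatMap _ _) ⟨
      map ((+ 1 , unitE m 1) ·_) (quotientTerms 1 e)
        ≡⟨ LP.++-identityʳ _ ⟨
      quotientsUpTo 1 e ∎
      where open SetoidReasoning ≈-setoid

    childTerms-suc : ∀ i → suc (suc i) ≤ m → childTerms (suc (suc i)) ≈ childTerms (suc i) ++ quotientPart (suc (suc i)) e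
    childTerms-suc i j≤m = begin
      childTerms j
        ≈⟨ concatMap-guard-∨ (λ x → maxStart j π <ᵇ top x) (λ x → maxStart k π <ᵇ top x) between _ (range0 nb)
             (λ x _ → split-implied _ _ (λ h → <⇒<ᵇ (≤-<-trans (maxStart-suc π k 1≤k) (<ᵇ⇒< _ (top x) h))))
             (λ x _ → split-implied-disjoint (maxStart j π <ᵇ top x) (maxStart k π <ᵇ top x)) ⟩
      childTerms k ++ concatMap (λ x → guard (between x) (term (π ++ x ∷ []) ∷ [])) (range0 nb)
        ≡⟨ cong (childTerms k ++_) (concatMap-cong-∈ _ _ (range0 nb) (λ x x∈ → guard-cong (between x) λ h →
             cong (λ f → (+ 1 , f) ∷ []) (child-aVec j x (s≤s z≤n) j≤m (∈-range0⁻ nb x∈) (<ᵇ⇒< _ (top x) (T-∧-fst h))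
               (λ _ → ≮⇒≥ (λ lt → T-not⁻ (T-∧-snd {maxStart j π <ᵇ top x} h) (<⇒<ᵇ lt))) (onesUpTo m j) (getE-onesUpTo m j)))) ⟩
      childTerms k ++ concatMap (λ x → guard (between x) (shifted (onesUpTo m j) j (suc (blocksAbove π (top x))))) (range0 nb)
        ≈⟨ ++-cong ≈-refl (ranks-between (onesUpTo m j) j (maxStart-suc π k 1≤k)) ⟩
      childTerms k ++ concatMap (shifted (onesUpTo m j) j) (upFrom (suc c-k) (c-j ∸ c-k))
        ≡⟨ cong (childTerms k ++_) (cong₂ (λ a b → concatMap (shifted (onesUpTo m j) j) (upFrom a (b ∸ a)))
             (getE-aVec-blocksAbove π rg k 1≤k (≤-trans (n≤1+n k) j≤m)) (getE-aVec-blocksAbove π rg j (s≤s z≤n) j≤m)) ⟨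
      childTerms k ++ concatMap (shifted (onesUpTo m j) j) (upFrom (getE e k) (getE e j ∸ getE e k))
        ≡⟨ cong (childTerms k ++_) (trans (sym (LP.map-∘ (upFrom (getE e k) _))) (map-as-concatMap _ _)) ⟨
      childTerms k ++ quotientPart j e ∎
      where
      open SetoidReasoning ≈-setoid
      k = suc i
      j = suc k
      1≤k : 1 ≤ k
      1≤k = s≤s z≤n
      between : ℕ → Bool
      between x = (maxStart j π <ᵇ top x) ∧ not (maxStart k π <ᵇ top x)
      c-k = blocksAbove π (maxStart k π)
      c-j = blocksAbove π (maxStart j π)

    childTerms≈quotientsUpTo : ∀ k → 1 ≤ k → k ≤ m → childTerms k ≈ quotientsUpTo k e
    childTerms≈quotientsUpTo (suc zero) _ _ = childTerms-1
    childTerms≈quotientsUpTo (suc (suc k)) _ k≤m = begin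
      childTerms (suc (suc k))
        ≈⟨ childTerms-suc k k≤m ⟩
      childTerms (suc k) ++ quotientPart (suc (suc k)) e
        ≈⟨ ++-cong (childTerms≈quotientsUpTo (suc k) (s≤s z≤n) (≤-trans (n≤1+n _) k≤m)) ≈-refl ⟩
      quotientsUpTo (suc k) e ++ quotientPart (suc (suc k)) e
        ≡⟨ LP.++-assoc (map ((+ 1 , unitE m 1) ·_) (quotientTerms 1 e)) _ _ ⟩
      map ((+ 1 , unitE m 1) ·_) (quotientTerms 1 e) ++ (concatMap (λ j → quotientPart j e) (rangeFT 2 (suc k)) ++ quotientPart (suc (suc k)) e)
        ≡⟨ cong (map ((+ 1 , unitE m 1) ·_) (quotientTerms 1 e) ++_) (trans (cong (concatMap (λ j → quotientPart j e) (rangeFT 2 (suc k)) ++_) (sym (LP.++-identityʳ (quotientPart (suc (suc k)) e))))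
             (trans (sym (LP.concatMap-++ (λ j → quotientPart j e) (rangeFT 2 (suc k)) _)) (cong (concatMap (λ j → quotientPart j e)) (sym (rangeFT-suc 2 (suc k) (s≤s (s≤s z≤n))))))) ⟩
      quotientsUpTo (suc (suc k)) e ∎
      where open SetoidReasoning ≈-setoid

    aVec-new-block : aVec m (π ++ nb ∷ []) ≡ addE (onesUpTo m m) e
    aVec-new-block = getE-ext _ _ coordinate
      where
      coordinate : ∀ i → 1 ≤ i → i ≤ m → getE (aVec m (π ++ nb ∷ [])) i ≡ getE (addE (onesUpTo m m) e) i
      coordinate i 1≤i i≤m = begin
        getE (aVec m (π ++ nb ∷ [])) i           ≡⟨ getE-aVec m (π ++ nb ∷ []) i 1≤i i≤m ⟩
        aStat i (π ++ nb ∷ [])                   ≡⟨ Append.NewBlock.aStat-new π nb rg ≤-refl refl i ⟩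
        1 + aStat i π                            ≡⟨ cong₂ _+_ (trans (getE-onesUpTo m m i 1≤i i≤m) (cong (λ b → if b then 1 else 0) (T-true (≤⇒≤ᵇ i≤m))))
                                                              (getE-aVec m π i 1≤i i≤m) ⟨
        getE (onesUpTo m m) i + getE e i         ≡⟨ getE-addE (onesUpTo m m) e i ⟨
        getE (addE (onesUpTo m m) e) i           ∎
        where open ≡-Reasoning

    extensionTerms≈rhsTerms : T (inΠ m π) → extensionTerms π ≈ rhsTerms π
    extensionTerms≈rhsTerms inΠπ = begin
      extensionTerms π
        ≡⟨ LP.concatMap-++ (λ x → guard (inΠ m (π ++ x ∷ [])) (term (π ++ x ∷ []) ∷ [])) (range0 nb) (nb ∷ []) ⟩
      concatMap (λ x → guard (inΠ m (π ++ x ∷ [])) (term (π ++ x ∷ []) ∷ [])) (range0 nb)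
        ++ guard (inΠ m (π ++ nb ∷ [])) (term (π ++ nb ∷ []) ∷ []) ++ []
        ≡⟨ cong₂ _++_ old-blocks (trans (LP.++-identityʳ _) new-block) ⟩
      childTerms m ++ (+ 1 , addE (onesUpTo m m) e) ∷ []
        ≈⟨ ++-cong (childTerms≈quotientsUpTo m 1≤m ≤-refl) ≈-refl ⟩
      quotientsUpTo m e ++ (+ 1 , addE (onesUpTo m m) e) ∷ []
        ≈⟨ ++-comm-≈ (quotientsUpTo m e) _ ⟩
      rhsTerms π ∎
      where
      open SetoidReasoning ≈-setoid
      old-blocks : concatMap (λ x → guard (inΠ m (π ++ x ∷ [])) (term (π ++ x ∷ []) ∷ [])) (range0 nb) ≡ childTerms m
      old-blocks = concatMap-cong-∈ _ _ (range0 nb) λ x x∈ → let x<nb = ∈-range0⁻ nb x∈ in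
        cong (λ b → guard b (term (π ++ x ∷ []) ∷ [])) (Append.OldBlock.inΠ-old π x rg (<⇒≤ x<nb) x<nb m 1≤m inΠπ)
      new-block : guard (inΠ m (π ++ nb ∷ [])) (term (π ++ nb ∷ []) ∷ []) ≡ (+ 1 , addE (onesUpTo m m) e) ∷ []
      new-block rewrite T-true (Append.NewBlock.inΠ-new π nb rg ≤-refl refl m inΠπ) = cong (λ f → (+ 1 , f) ∷ []) aVec-new-block

  Ftilde-suc : ∀ n → Ftilde m (suc n) ≈ concatMap extensionTerms (admissible n)
  Ftilde-suc n = begin
    map term (bfilter (inΠ m) (partitionsOf (suc n)))
      ≈⟨ ↭⇒≈ (↭P.map⁺ term (bfilter-↭ (inΠ m) (partitionsOf-suc↭extensions n))) ⟩
    map term (bfilter (inΠ m) (extensions n))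
      ≡⟨ trans (cong (map term) (bfilter-concatMap (inΠ m) _ (partitionsOf n))) (LP.map-concatMap term _ (partitionsOf n)) ⟩
    concatMap (λ π → map term (bfilter (inΠ m) (map (λ x → π ++ x ∷ []) (range0 (suc (nblocks π)))))) (partitionsOf n)
      ≡⟨ concatMap-cong-∈ _ extensionTerms (partitionsOf n) (λ π _ → map-bfilter-map term (inΠ m) (λ x → π ++ x ∷ []) (range0 (suc (nblocks π)))) ⟩
    concatMap extensionTerms (partitionsOf n)
      ≡⟨ concatMap-bfilter (inΠ m) extensionTerms (partitionsOf n) no-extension ⟨
    concatMap extensionTerms (admissible n) ∎
    where
    open SetoidReasoning ≈-setoid
    -- a nesting of π is also one of any extension of π
    no-extension : ∀ π → π ∈ partitionsOf n → ¬ T (inΠ m π) → extensionTerms π ≡ []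
    no-extension π π∈ π∉ = concatMap-[] _ (range0 (suc (nblocks π))) λ x x∈ →
      cong (λ b → guard b (term (π ++ x ∷ []) ∷ [])) (¬T-false (π∉ ∘ Append.inΠ-init π x (proj₁ (∈-partitionsOf⁻ n π∈))
                                                                     (s≤s⁻¹ (∈-range0⁻ (suc (nblocks π)) x∈)) m))

  RHS-suc : ∀ n → RHS m Q (suc n) ≈ concatMap rhsTerms (admissible n)
  RHS-suc n = begin
    (prodU m m ⊗ Ftilde m n) ++ ((var m 1 ⊗ Q 1 n) ++ sumF (map (λ j → tF (prodU m j ·F Q j)) (rangeFT 2 m)) (suc n))
      ≈⟨ ++-cong new-blocks (++-cong first-quotient other-quotients) ⟩
    concatMap (λ π → (+ 1 , addE (onesUpTo m m) (aVec m π)) ∷ []) P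
      ++ (concatMap (λ π → map ((+ 1 , unitE m 1) ·_) (quotientTerms 1 (aVec m π))) P
      ++ concatMap (λ π → concatMap (λ j → quotientPart j (aVec m π)) (rangeFT 2 m)) P)
      ≈⟨ ++-cong ≈-refl (concatMap-++-≈ _ _ P) ⟨
    concatMap (λ π → (+ 1 , addE (onesUpTo m m) (aVec m π)) ∷ []) P ++ concatMap (quotientsUpTo m ∘ aVec m) P
      ≈⟨ concatMap-++-≈ _ _ P ⟨
    concatMap rhsTerms P ∎
    where
    open SetoidReasoning ≈-setoid
    P = admissible n
    sumF-suc : ∀ js → sumF (map (λ j → tF (prodU m j ·F Q j)) js) (suc n) ≡ concatMap (λ j → prodU m j ⊗ Q j n) js
    sumF-suc [] = refl
    sumF-suc (j ∷ js) = cong ((prodU m j ⊗ Q j n) ++_) (sumF-suc js)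
    new-blocks : prodU m m ⊗ Ftilde m n ≈ concatMap (λ π → (+ 1 , addE (onesUpTo m m) (aVec m π)) ∷ []) P
    new-blocks = ≡⇒≈ (trans (LP.++-identityʳ _) (trans (sym (LP.map-∘ P)) (map-as-concatMap _ P)))
    first-quotient : var m 1 ⊗ Q 1 n ≈ concatMap (λ π → map ((+ 1 , unitE m 1) ·_) (quotientTerms 1 (aVec m π))) P
    first-quotient = ≡⇒≈ (trans (LP.++-identityʳ _) (LP.map-concatMap _ (quotientTerms 1 ∘ aVec m) P))
    other-quotients : sumF (map (λ j → tF (prodU m j ·F Q j)) (rangeFT 2 m)) (suc n)
                        ≈ concatMap (λ π → concatMap (λ j → quotientPart j (aVec m π)) (rangeFT 2 m)) P
    other-quotients = begin
      sumF (map (λ j → tF (prodU m j ·F Q j)) (rangeFT 2 m)) (suc n)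
        ≡⟨ sumF-suc (rangeFT 2 m) ⟩
      concatMap (λ j → prodU m j ⊗ Q j n) (rangeFT 2 m)
        ≡⟨ concatMap-cong-∈ _ _ (rangeFT 2 m) (λ j _ → trans (LP.++-identityʳ _) (LP.map-concatMap _ (quotientTerms j ∘ aVec m) P)) ⟩
      concatMap (λ j → concatMap (λ π → quotientPart j (aVec m π)) P) (rangeFT 2 m)
        ≈⟨ concatMap-comm-≈ (λ j π → quotientPart j (aVec m π)) (rangeFT 2 m) P ⟩
      concatMap (λ π → concatMap (λ j → quotientPart j (aVec m π)) (rangeFT 2 m)) P ∎

  aVec-[] : aVec m [] ≡ onesUpTo m m
  aVec-[] = getE-ext _ _ λ i 1≤i i≤m → trans (getE-aVec m [] i 1≤i i≤m) (trans (aStat≡blocksAbove [] i tt)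
    (sym (trans (getE-onesUpTo m m i 1≤i i≤m) (cong (λ b → if b then 1 else 0) (T-true (≤⇒≤ᵇ i≤m))))))

  functional-equation : ∀ n → Ftilde m n ≈ RHS m Q n
  functional-equation zero = ≡⇒≈ (cong₂ (λ e rest → (+ 1 , e) ∷ [] ++ rest) aVec-[] (sym (sumF-zero (rangeFT 2 m))))
    where
    sumF-zero : ∀ js → [] ++ ([] ++ sumF (map (λ j → tF (prodU m j ·F Q j)) js) 0) ≡ []
    sumF-zero [] = refl
    sumF-zero (j ∷ js) = sumF-zero js
  functional-equation (suc n) = begin
    Ftilde m (suc n)                          ≈⟨ Ftilde-suc n ⟩
    concatMap extensionTerms (admissible n)   ≈⟨ concatMap-cong-≈ extensionTerms rhsTerms (admissible n) (λ π π∈ →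
                                                   let (rg , inΠπ) = ∈-admissible⁻ {n} π∈ in Children.extensionTerms≈rhsTerms π rg inΠπ) ⟩
    concatMap rhsTerms (admissible n)         ≈⟨ RHS-suc n ⟨
    RHS m Q (suc n)                           ∎
    where open SetoidReasoning ≈-setoid

proposition2 : (m : ℕ) → 1 ≤ m →
    Σ (ℕ → FPS m) (λ Q →
      ((j : ℕ) → 1 ≤ j → j ≤ m → IsQuotient m j (Q j))
      × (Ftilde m ≈F RHS m Q))
proposition2 m 1≤m = Q , quotient , coeffs ∘ functional-equation
  where open FunctionalEquation m 1≤m
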